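{- For $m\ge1$ and $n\ge0$, $$\mathcal{SA}_{m,n}=\{\mathbf x^{\eta(\omega)}\theta_{T(\omega)}:\ \omega\text{ an ordered super set partition of }[n^m]\}.$$
   Context: For $T\subseteq[n]$, $\theta_T=\prod_{i\in T}\theta_i$ (anticommuting variables, product in increasing order); $\mathbf x^\alpha=x_1^{\alpha_1}\cdots x_n^{\alpha_n}$. For $T\subseteq[n]$ with complement $\{u_1<\dots<u_k\}$, $u_0=0$, $u_{k+1}=n+1$, define $\beta(T)$ by $\beta_{u_i}=im-1$ ($i\in[k]$) and $\beta_t=im-2$ for $t\in T$ with $u_{i-1}<t<u_i$. $\mathcal{SA}_{m,n}=\{\mathbf x^\alpha\theta_T:T\subseteq[n],\ \alpha\le\beta(T)\text{ componentwise}\}$ ($\alpha$ a weak composition). Let $\zeta_m=e^{2\pi i/m}$, $i^c=\zeta_m^c\mathbf e_i$ for $i\in[n]$ (colors mod $m$), $[n^m]=\{0\}\cup\{i^c:i\in[n],0\le c<m\}$, $zS=\{zs:s\in S\}$. A colored set partition of type $(m,n)$ is a set partition of $[n^m]$ into blocks $S_0,\dots,S_{km}$ with (i) $0\in S_0$ and if some $i^c\in S_0$ then all $i^d\in S_0$; (ii) the nonzero blocks split into $k$ groups of $m$ distinct blocks of the form $S,\zeta_mS,\dots,\zeta_m^{m-1}S$. A super set partition additionally carries, for each base $i$ with colors in $S_0$, a linear order of $\{i^0,\dots,i^{m-1}\}$ of the form $i^c,i^{c+1},\dots,i^{c+m-1}$ (exponents mod $m$) with $c\in\{1,\dots,m-1\}$.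 An ordered super set partition is a sequence $\omega=(S_0/S_1/\dots/S_{km})$ (any $k\ge0$) forming a super set partition with zero block $S_0$ and with $S_{i+1}=\zeta_mS_i$ for all $i\in[km-1]$ not divisible by $m$. $\operatorname{minb}S$ is $0$ if $0\in S$, else the least base in $S$. Inversions of $\omega$: (1) pairs $(i^0,S_l)$ with $i^0\in S_j$, $j<l$, $i\ge\operatorname{minb}S_l$; (2) pairs $(i^0,i^c)$ with $i^0,i^c\in S_0$, $i^c$ after $i^0$ in the order of base $i$. $\operatorname{inv}_s\omega$ is the number of inversions with first component $s^0$, and $\eta(\omega)=(\operatorname{inv}_1\omega,\dots,\operatorname{inv}_n\omega)$. $T(\omega)=\{t\in[n]: t>\operatorname{minb}S_i\text{ where }S_i\text{ is the block containing }t^0\}$. -}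

module Defs where

open import Data.Bool using (Bool; true; false; if_then_else_; _∧_; not)
open import Data.Nat using (ℕ; zero; suc; _+_; _*_; _∸_; _<_; _≤_; _<?_; _≤?_; NonZero)
open import Data.Nat.DivMod using (_%_)
open import Data.Nat.Divisibility using (_∣_)
open import Data.Integer as ℤ using (ℤ; +_)
open import Data.Fin as Fin using (Fin; toℕ; lower₁)
open import Data.Fin.Properties using (any?)
open import Data.Fin.Subset using (Subset; _∈_)
open import Data.Fin.Subset.Properties using (_∈?_)
open import Data.Vec using (Vec; tabulate; lookup)
open import Data.Product using (Σ; ∃; _×_; _,_)
open import Function using (_∘_)
open import Function.Bundles using (_⇔_)
open import Relation.Nullary using (¬_; yes; no)
open import Relation.Nullary.Decidable using (⌊_⌋)
open import Relation.Binary.PropositionalEquality using (_≡_; _≢_)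

countF : ∀ {k} → (Fin k → Bool) → ℕ
countF {zero}  p = 0
countF {suc k} p = (if p Fin.zero then 1 else 0) + countF (p ∘ Fin.suc)

-- 1-based position of the least i with p i = true
-- (returns k when there is none; only used on nonempty blocks)
firstIdx : ∀ {k} → (Fin k → Bool) → ℕ
firstIdx {zero}  p = 0
firstIdx {suc k} p = if p Fin.zero then 1 else suc (firstIdx (p ∘ Fin.suc))

c0 : ∀ {m} {{_ : NonZero m}} → Fin m
c0 {suc m} = Fin.zero

rot : ∀ {m} → Fin m → Fin m
rot {suc m} i with m Data.Nat.≟ toℕ i
... | yes _ = Fin.zero
... | no p  = lower₁ (Fin.suc i) (λ e → p (Data.Nat.Properties.suc-injective e))
  where import Data.Nat.Properties

-- The points of [n^m]: 0 and i^c (base i : Fin n is the base i+1 of the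
-- paper, colour c : Fin m).

data Pt (n m : ℕ) : Set where
  origin : Pt n m
  col    : Fin n → Fin m → Pt n m

ζ : ∀ {n m} → Pt n m → Pt n m
ζ origin    = origin
ζ (col i c) = col i (rot c)

-- minb of the block with index l of an assignment blk of points to blocks
-- (bases are 1-based as in the paper)

minb : ∀ {n m K} → (Pt n m → Fin K) → Fin K → ℕ
minb {n} {m} blk l with blk origin Fin.≟ l
... | yes _ = 0
... | no  _ = firstIdx (λ (i : Fin n) → ⌊ any? (λ (c : Fin m) → blk (col i c) Fin.≟ l) ⌋)

-- The sequence of blocks is encoded by the map blk sending a point to the
-- index of the block containing it: S_l = { x | blk x ≡ l }.  Surjectivity of
-- blk says every block is nonempty; disjointness and covering are automatic.

record OSSP (m n : ℕ) {{_ : NonZero m}} : Set where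
  field
    k       : ℕ
    blk     : Pt n m → Fin (suc (k * m))
    nonempty : ∀ (l : Fin (suc (k * m))) → ∃ λ x → blk x ≡ l
    zero∈S₀ : blk origin ≡ Fin.zero
    S₀-closed : ∀ i c d → blk (col i c) ≡ Fin.zero → blk (col i d) ≡ Fin.zero
    shift : ∀ (l : ℕ) → 1 ≤ l → l < k * m → ¬ (m ∣ l) →
            ∀ x → (toℕ (blk x) ≡ l) ⇔ (toℕ (blk (ζ x)) ≡ suc l)
    -- super structure: for a base i whose colours lie in S_0 the linear order
    -- i^c, i^{c+1}, …, i^{c+m-1} with c = start i ∈ {1,…,m-1}
    start    : Fin n → Fin m
    start-ok : ∀ i → blk (col i c0) ≡ Fin.zero → start i ≢ c0

module _ {m n : ℕ} {{_ : NonZero m}} (ω : OSSP m n) where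
  open OSSP ω

  -- position of i^d in the linear order of base i
  pos : Fin n → Fin m → ℕ
  pos i d = (toℕ d + (m ∸ toℕ (start i))) % m

  inv₁ : Fin n → ℕ
  inv₁ s = countF (λ l → ⌊ toℕ (blk (col s c0)) <? toℕ l ⌋
                         ∧ ⌊ minb blk l ≤? suc (toℕ s) ⌋)

  inv₂ : Fin n → ℕ
  inv₂ s = countF (λ d → ⌊ blk (col s c0) Fin.≟ Fin.zero ⌋
                         ∧ ⌊ blk (col s d) Fin.≟ Fin.zero ⌋
                         ∧ ⌊ pos s c0 <? pos s d ⌋)

  η : Vec ℕ n
  η = tabulate (λ s → inv₁ s + inv₂ s)

  Tω : Subset n
  Tω = tabulate (λ t → ⌊ minb blk (blk (col t c0)) <? suc (toℕ t) ⌋)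

-- The monomial x^α θ_T is recorded as the pair (α , T).

Monomial : ℕ → Set
Monomial n = Vec ℕ n × Subset n

-- β(T)_t : with i-index computed as the number of u ∉ T with u ≤ t
β : ∀ {n} → ℕ → Subset n → Fin n → ℤ
β {n} m T t =
  let cnt = countF (λ (u : Fin n) → not ⌊ u ∈? T ⌋ ∧ ⌊ toℕ u ≤? toℕ t ⌋)
  in if ⌊ t ∈? T ⌋ then (+ (suc cnt * m)) ℤ.- + 2 else (+ (cnt * m)) ℤ.- + 1

_∈SA[_] : ∀ {n} → Monomial n → ℕ → Set
_∈SA[_] {n} (α , T) m = ∀ (t : Fin n) → + (lookup α t) ℤ.≤ β m T t

_∈Im[_] : ∀ {n} → Monomial n → (m : ℕ) → {{NonZero m}} → Set
_∈Im[_] {n} mono m = ∃ λ (ω : OSSP m n) → (η ω , Tω ω) ≡ mono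

{-# OPTIONS --safe #-}

-- The exponent η(ω)_t counts the blocks after the block of t^0 whose least base is at most t,
-- plus, if t^0 ∈ S_0 is ordered t^s, t^{s+1}, …, the s ∸ 1 colours after t^0. Since ζ permutes
-- the blocks of each group, a base u that is not the least base of its own block is not the least
-- base of any block, and a base that is has its m colours in at most m blocks. Counting blocks by
-- their least base therefore gives η(ω)_t ≤ β(T(ω))_t.
--
-- Conversely a monomial x^α θ_T of SA_{m,n} is realised by adding the bases in increasing order.
-- A base t ∈ T goes into S_0 with a suitable start colour or has its colours spread over an
-- existing group of m blocks; a base t ∉ T opens a new group. The position and the rotation of
-- the colours are chosen so that exactly α_t blocks follow the block of t^0, and as t is the
-- largest base so far, the exponents and T-membership of the earlier bases do not change.

module Submission where

open import Defs
open import Data.Bool using (Bool; true; false; T; _∧_; _∨_; not; if_then_else_)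
open import Data.Bool.Properties using (T-∧; T-∨; ∧-identityʳ; ∧-zeroʳ)
open import Data.Empty using (⊥-elim)
open import Data.Fin as Fin using (Fin; toℕ; fromℕ; fromℕ<; inject₁)
open import Data.Fin.Properties using (any?; toℕ<n; toℕ-injective; toℕ-inject₁; toℕ-fromℕ; toℕ-fromℕ<; toℕ-lower₁)
open import Data.Fin.Relation.Unary.Top using (view; ‵fromℕ; ‵inj₁)
open import Data.Fin.Subset using (Subset)
open import Data.Fin.Subset.Properties using (_∈?_)
open import Data.Integer as ℤ using (ℤ)
open import Data.Integer.Properties using (m-n≡m⊖n; ⊖-≥; ⊖-<; drop‿+≤+)
open import Data.Nat using (ℕ; zero; suc; _+_; _*_; _∸_; _≤_; _<_; z≤n; s≤s; _<?_; _≤?_; _≟_; NonZero)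
open import Data.Nat.Properties
open import Data.Nat.DivMod
  using (_%_; _/_; %-distribˡ-+; m%n%n≡m%n; n%n≡0; m<n⇒m%n≡m; [m+n]%n≡m%n; [m+kn]%n≡m%n; m%n<n; m<n*o⇒m/o<n; m≡m%n+[m/n]*n)
open import Data.Nat.Divisibility using (_∣_; _∣?_; divides; n∣m*n; _∣0; n∣m⇒m%n≡0; ∣m∣n⇒∣m+n; ∣-refl)
open import Data.Nat.GeneralisedArithmetic using (iterate)
open import Data.Product using (Σ; ∃; ∃₂; _×_; _,_; proj₁; proj₂)
open import Data.Sum using (_⊎_; inj₁; inj₂)
open import Data.Unit using (tt)
open import Data.Vec using (Vec; _∷_; lookup)
open import Data.Vec.Properties using (lookup∘tabulate; tabulate∘lookup; tabulate-cong)
open import Function using (_∘_; id)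
open import Function.Bundles using (_⇔_; mk⇔; Equivalence)
open import Function.Properties.Equivalence using () renaming (trans to ⇔-trans; sym to ⇔-sym)
open import Relation.Binary.Definitions using (tri<; tri≈; tri>)
open import Relation.Binary.PropositionalEquality using (_≡_; _≢_; refl; sym; trans; cong; cong₂; subst; subst₂; module ≡-Reasoning)
open import Relation.Nullary using (¬_; Dec; yes; no)
open import Relation.Nullary.Decidable using (⌊_⌋; isYes≗does; dec-true; dec-false; does-⇔; toWitness; fromWitness)
open import Algebra.Properties.CommutativeSemigroup +-commutativeSemigroup using (interchange; x∙yz≈y∙xz)
open Equivalence using (to; from)

⌊⌋-true : ∀ {a} {A : Set a} (a? : Dec A) → A → ⌊ a? ⌋ ≡ true
⌊⌋-true a? a = trans (isYes≗does a?) (dec-true a? a)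

⌊⌋-false : ∀ {a} {A : Set a} (a? : Dec A) → ¬ A → ⌊ a? ⌋ ≡ false
⌊⌋-false a? ¬a = trans (isYes≗does a?) (dec-false a? ¬a)

⌊⌋-⇔ : ∀ {a b} {A : Set a} {B : Set b} → A ⇔ B → (a? : Dec A) (b? : Dec B) → ⌊ a? ⌋ ≡ ⌊ b? ⌋
⌊⌋-⇔ A⇔B a? b? = trans (isYes≗does a?) (trans (does-⇔ A⇔B a? b?) (sym (isYes≗does b?)))

T-⌊⌋∧⌊⌋ : ∀ {a b} {A : Set a} {B : Set b} (a? : Dec A) (b? : Dec B) → T (⌊ a? ⌋ ∧ ⌊ b? ⌋) → A × B
T-⌊⌋∧⌊⌋ a? b? p = let (x , y) = to (T-∧ {⌊ a? ⌋}) p in toWitness x , toWitness y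

⌊⌋∧⌊⌋-T : ∀ {a b} {A : Set a} {B : Set b} (a? : Dec A) (b? : Dec B) → A → B → T (⌊ a? ⌋ ∧ ⌊ b? ⌋)
⌊⌋∧⌊⌋-T a? b? x y = from (T-∧ {⌊ a? ⌋}) (fromWitness x , fromWitness y)

indicator : Bool → ℕ
indicator b = if b then 1 else 0

count : ℕ → (ℕ → Bool) → ℕ
count zero    P = 0
count (suc K) P = indicator (P 0) + count K (P ∘ suc)

countF-toℕ : ∀ K (P : ℕ → Bool) → countF {K} (P ∘ toℕ) ≡ count K P
countF-toℕ zero    P = refl
countF-toℕ (suc K) P = cong (indicator (P 0) +_) (countF-toℕ K (P ∘ suc))

countF-cong : ∀ {K} {p q : Fin K → Bool} → (∀ i → p i ≡ q i) → countF p ≡ countF q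
countF-cong {zero}  e = refl
countF-cong {suc K} e = cong₂ (λ b c → indicator b + c) (e Fin.zero) (countF-cong (e ∘ Fin.suc))

countF-none : ∀ {K} (p : Fin K → Bool) → (∀ i → ¬ T (p i)) → countF p ≡ 0
countF-none {zero}  p none = refl
countF-none {suc K} p none with p Fin.zero | none Fin.zero
... | false | _   = countF-none (p ∘ Fin.suc) (none ∘ Fin.suc)
... | true  | ¬p0 = ⊥-elim (¬p0 _)

countF-snoc : ∀ {n} (p : Fin (suc n) → Bool) → countF p ≡ countF (p ∘ inject₁) + indicator (p (fromℕ n))
countF-snoc {zero}  p = +-comm (indicator (p Fin.zero)) 0
countF-snoc {suc n} p = trans (cong (indicator (p Fin.zero) +_) (countF-snoc (p ∘ Fin.suc)))
                              (sym (+-assoc (indicator (p Fin.zero)) _ _))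

count-cong : ∀ K {P Q : ℕ → Bool} → (∀ j → j < K → P j ≡ Q j) → count K P ≡ count K Q
count-cong zero    e = refl
count-cong (suc K) e = cong₂ (λ b c → indicator b + c) (e 0 (s≤s z≤n)) (count-cong K (λ j j<K → e (suc j) (s≤s j<K)))

count-+ : ∀ a b P → count (a + b) P ≡ count a P + count b (P ∘ (a +_))
count-+ zero    b P = refl
count-+ (suc a) b P = trans (cong (indicator (P 0) +_) (count-+ a b (P ∘ suc))) (sym (+-assoc (indicator (P 0)) _ _))

count-snoc : ∀ K P → count (suc K) P ≡ count K P + indicator (P K)
count-snoc K P = begin
  count (suc K) P                            ≡⟨ cong (λ K′ → count K′ P) (+-comm 1 K) ⟩
  count (K + 1) P                            ≡⟨ count-+ K 1 P ⟩
  count K P + (indicator (P (K + 0)) + 0)    ≡⟨ cong (count K P +_) (trans (+-identityʳ _) (cong (indicator ∘ P) (+-identityʳ K))) ⟩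
  count K P + indicator (P K)                ∎
  where open ≡-Reasoning

indicator-mono : ∀ {a b} → (T a → T b) → indicator a ≤ indicator b
indicator-mono {false}         _ = z≤n
indicator-mono {true}  {true}  _ = ≤-refl
indicator-mono {true}  {false} f = ⊥-elim (f _)

count-mono : ∀ K {P Q : ℕ → Bool} → (∀ j → j < K → T (P j) → T (Q j)) → count K P ≤ count K Q
count-mono zero    f = z≤n
count-mono (suc K) f = +-mono-≤ (indicator-mono (f 0 (s≤s z≤n))) (count-mono K (λ j j<K → f (suc j) (s≤s j<K)))

count-mono-< : ∀ K {P Q : ℕ → Bool} → (∀ j → j < K → T (P j) → T (Q j)) →
               ∀ j₀ → j₀ < K → ¬ T (P j₀) → T (Q j₀) → count K P < count K Q
count-mono-< (suc K) {P} {Q} f zero _ ¬P0 Q0 with P 0 | Q 0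
... | true  | _     = ⊥-elim (¬P0 _)
... | false | true  = s≤s (count-mono K (λ j j<K → f (suc j) (s≤s j<K)))
count-mono-< (suc K) f (suc j₀) (s≤s j₀<K) ¬P Q =
  +-mono-≤-< (indicator-mono (f 0 (s≤s z≤n))) (count-mono-< K (λ j j<K → f (suc j) (s≤s j<K)) j₀ j₀<K ¬P Q)

count-none : ∀ K {P : ℕ → Bool} → (∀ j → j < K → ¬ T (P j)) → count K P ≡ 0
count-none zero    none = refl
count-none (suc K) {P} none with P 0 | none 0 (s≤s z≤n)
... | false | _   = count-none K (λ j j<K → none (suc j) (s≤s j<K))
... | true  | ¬p0 = ⊥-elim (¬p0 _)

count-all : ∀ K {P : ℕ → Bool} → (∀ j → j < K → T (P j)) → count K P ≡ K
count-all zero    all = refl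
count-all (suc K) {P} all with P 0 | all 0 (s≤s z≤n)
... | true | _ = cong suc (count-all K (λ j j<K → all (suc j) (s≤s j<K)))

count-+-gap : ∀ a c b (P Q : ℕ → Bool) →
  (∀ j → j < a → P j ≡ Q j) → (∀ e → e < c → ¬ T (P (a + e))) → (∀ e → e < b → P (a + (c + e)) ≡ Q (a + e)) →
  count (a + (c + b)) P ≡ count (a + b) Q
count-+-gap a c b P Q below gap above = begin
  count (a + (c + b)) P                                              ≡⟨ count-+ a (c + b) P ⟩
  count a P + count (c + b) (P ∘ (a +_))                             ≡⟨ cong (count a P +_) (count-+ c b (P ∘ (a +_))) ⟩
  count a P + (count c (P ∘ (a +_)) + count b (P ∘ (a +_) ∘ (c +_))) ≡⟨ cong₂ _+_ (count-cong a below)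
                                                                          (cong₂ _+_ (count-none c gap) (count-cong b above)) ⟩
  count a Q + count b (Q ∘ (a +_))                                   ≡⟨ count-+ a b Q ⟨
  count (a + b) Q                                                    ∎
  where open ≡-Reasoning

indicator-∨ : ∀ a b → indicator (a ∨ b) ≤ indicator a + indicator b
indicator-∨ true  b = s≤s z≤n
indicator-∨ false b = ≤-refl

count-∨ : ∀ K P Q → count K (λ j → P j ∨ Q j) ≤ count K P + count K Q
count-∨ zero    P Q = z≤n
count-∨ (suc K) P Q = begin
  indicator (P 0 ∨ Q 0) + count K (λ j → P (suc j) ∨ Q (suc j))
    ≤⟨ +-mono-≤ (indicator-∨ (P 0) (Q 0)) (count-∨ K (P ∘ suc) (Q ∘ suc)) ⟩
  (indicator (P 0) + indicator (Q 0)) + (count K (P ∘ suc) + count K (Q ∘ suc))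
    ≡⟨ interchange (indicator (P 0)) (indicator (Q 0)) _ _ ⟩
  (indicator (P 0) + count K (P ∘ suc)) + (indicator (Q 0) + count K (Q ∘ suc)) ∎
  where open ≤-Reasoning

count-≟ : ∀ K a → count K (λ j → ⌊ a ≟ j ⌋) ≤ 1
count-≟ zero    a       = z≤n
count-≟ (suc K) zero    = ≤-reflexive (cong suc (count-none K (λ j _ ())))
count-≟ (suc K) (suc a) = ≤-trans (≤-reflexive (count-cong K (λ j _ → ⌊⌋-⇔ ≡-suc⇔ (suc a ≟ suc j) (a ≟ j)))) (count-≟ K a)
  where ≡-suc⇔ : ∀ {a j} → (suc a ≡ suc j) ⇔ (a ≡ j)
        ≡-suc⇔ = mk⇔ suc-injective (cong suc)

count-> : ∀ K b → count K (λ j → ⌊ b <? j ⌋) ≡ K ∸ suc b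
count-> zero    b       = refl
count-> (suc K) zero    = count-all K (λ j _ → tt)
count-> (suc K) (suc b) = trans (count-cong K (λ j _ → ⌊⌋-⇔ (mk⇔ ≤-pred s≤s) (suc b <? suc j) (b <? j))) (count-> K b)

extendByFalse : ∀ {n} → (Fin n → Bool) → ℕ → Bool
extendByFalse {zero}  P j       = false
extendByFalse {suc n} P zero    = P Fin.zero
extendByFalse {suc n} P (suc j) = extendByFalse (P ∘ Fin.suc) j

extendByFalse-toℕ : ∀ {n} (P : Fin n → Bool) i → extendByFalse P (toℕ i) ≡ P i
extendByFalse-toℕ P Fin.zero    = refl
extendByFalse-toℕ P (Fin.suc i) = extendByFalse-toℕ (P ∘ Fin.suc) i

countF-≤ : ∀ {n} (P : Fin n → Bool) b → countF (λ u → P u ∧ ⌊ toℕ u ≤? b ⌋) ≡ count (suc b) (extendByFalse P)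
countF-≤ {zero}  P b = sym (count-none (suc b) {λ _ → false} (λ _ _ ()))
countF-≤ {suc n} P zero = cong₂ _+_ (cong indicator (∧-identityʳ (P Fin.zero)))
  (countF-none (λ u → P (Fin.suc u) ∧ false) (λ u p → subst T (∧-zeroʳ (P (Fin.suc u))) p))
countF-≤ {suc n} P (suc b) = cong₂ _+_ (cong indicator (∧-identityʳ (P Fin.zero)))
  (trans (countF-cong (λ u → cong (P (Fin.suc u) ∧_) (⌊⌋-⇔ (mk⇔ (≤-pred {toℕ u}) s≤s) (suc (toℕ u) ≤? suc b) (toℕ u ≤? b))))
         (countF-≤ (P ∘ Fin.suc) b))

firstIdx-≤ : ∀ {k} (p : Fin k → Bool) → firstIdx p ≤ k
firstIdx-≤ {zero}  p = z≤n
firstIdx-≤ {suc k} p with p Fin.zero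
... | true  = s≤s z≤n
... | false = s≤s (firstIdx-≤ (p ∘ Fin.suc))

firstIdx-≤-suc : ∀ {k} (p : Fin k → Bool) i → T (p i) → firstIdx p ≤ suc (toℕ i)
firstIdx-≤-suc {suc k} p i pi with p Fin.zero in eq
... | true = s≤s z≤n
firstIdx-≤-suc {suc k} p Fin.zero    pi | false = ⊥-elim (subst T eq pi)
firstIdx-≤-suc {suc k} p (Fin.suc i) pi | false = s≤s (firstIdx-≤-suc (p ∘ Fin.suc) i pi)

firstIdx-witness : ∀ {k} (p : Fin k → Bool) i → T (p i) → ∃ λ v → firstIdx p ≡ suc (toℕ v) × T (p v)
firstIdx-witness {suc k} p i pi with p Fin.zero in eq
... | true = Fin.zero , refl , subst T (sym eq) _
firstIdx-witness {suc k} p Fin.zero    pi | false = ⊥-elim (subst T eq pi)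
firstIdx-witness {suc k} p (Fin.suc i) pi | false with firstIdx-witness (p ∘ Fin.suc) i pi
... | v , fv , pv = Fin.suc v , cong suc fv , pv

firstIdx-cong : ∀ {k} {p q : Fin k → Bool} → (∀ i → p i ≡ q i) → firstIdx p ≡ firstIdx q
firstIdx-cong {zero}          e = refl
firstIdx-cong {suc k} {p} {q} e with p Fin.zero | q Fin.zero | e Fin.zero
... | true  | true  | refl = refl
... | false | false | refl = cong suc (firstIdx-cong (e ∘ Fin.suc))

firstIdx-inject₁ : ∀ {n} (p : Fin (suc n) → Bool) i → T (p (inject₁ i)) → firstIdx p ≡ firstIdx (p ∘ inject₁)
firstIdx-inject₁ {suc n} p i pi with p Fin.zero in eq
... | true = refl
firstIdx-inject₁ {suc n} p Fin.zero    pi | false = ⊥-elim (subst T eq pi)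
firstIdx-inject₁ {suc n} p (Fin.suc i) pi | false = cong suc (firstIdx-inject₁ (p ∘ Fin.suc) i pi)

firstIdx-none : ∀ {n} (p : Fin (suc n) → Bool) → (∀ i → ¬ T (p (inject₁ i))) → firstIdx p ≡ suc n
firstIdx-none {zero}  p none with p Fin.zero
... | true  = refl
... | false = refl
firstIdx-none {suc n} p none with p Fin.zero | none Fin.zero
... | true  | ¬p0 = ⊥-elim (¬p0 _)
... | false | _   = cong suc (firstIdx-none (p ∘ Fin.suc) (none ∘ Fin.suc))

⌊any?⌋-suc : ∀ {m} {P : Fin (suc m) → Set} (P? : ∀ c → Dec (P c)) →
             ⌊ any? P? ⌋ ≡ ⌊ P? Fin.zero ⌋ ∨ ⌊ any? (P? ∘ Fin.suc) ⌋
⌊any?⌋-suc P? = trans (isYes≗does (any? P?)) (sym (cong₂ _∨_ (isYes≗does (P? Fin.zero)) (isYes≗does (any? (P? ∘ Fin.suc)))))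

count-image : ∀ {m} K (f : Fin m → ℕ) → count K (λ j → ⌊ any? (λ c → f c ≟ j) ⌋) ≤ m
count-image {zero}  K f = ≤-reflexive (count-none K (λ _ _ ()))
count-image {suc m} K f = begin
  count K (λ j → ⌊ any? (λ c → f c ≟ j) ⌋)
    ≡⟨ count-cong K (λ j _ → ⌊any?⌋-suc (λ c → f c ≟ j)) ⟩
  count K (λ j → ⌊ f Fin.zero ≟ j ⌋ ∨ ⌊ any? (λ c → f (Fin.suc c) ≟ j) ⌋)
    ≤⟨ count-∨ K _ _ ⟩
  count K (λ j → ⌊ f Fin.zero ≟ j ⌋) + count K (λ j → ⌊ any? (λ c → f (Fin.suc c) ≟ j) ⌋)
    ≤⟨ +-mono-≤ (count-≟ K (f Fin.zero)) (count-image K (f ∘ Fin.suc)) ⟩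
  suc m ∎
  where open ≤-Reasoning

iterate-suc : ∀ {a} {A : Set a} (f : A → A) x j → iterate f x (suc j) ≡ f (iterate f x j)
iterate-suc f x zero    = refl
iterate-suc f x (suc j) = iterate-suc f (f x) j

module _ {m' : ℕ} where
  private M = suc m'

  %-+ˡ : ∀ x j → (x % M + j) % M ≡ (x + j) % M
  %-+ˡ x j = begin
    (x % M + j) % M             ≡⟨ %-distribˡ-+ (x % M) j M ⟩
    (x % M % M + j % M) % M     ≡⟨ cong (λ y → (y + j % M) % M) (m%n%n≡m%n x M) ⟩
    (x % M + j % M) % M         ≡⟨ %-distribˡ-+ x j M ⟨
    (x + j) % M                 ∎
    where open ≡-Reasoning

  g<k∧r<M⇒g*M+r<k*M : ∀ {g k r} → g < k → r < M → g * M + r < k * M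
  g<k∧r<M⇒g*M+r<k*M {g} {k} {r} g<k r<M = begin-strict
    g * M + r   <⟨ +-monoʳ-< (g * M) r<M ⟩
    g * M + M   ≡⟨ +-comm (g * M) M ⟩
    suc g * M   ≤⟨ *-monoˡ-≤ M g<k ⟩
    k * M       ∎
    where open ≤-Reasoning

  0<r<M⇒M∤g*M+r : ∀ g {r} → 0 < r → r < M → ¬ (M ∣ g * M + r)
  0<r<M⇒M∤g*M+r g {r} 0<r r<M M∣ = <⇒≢ 0<r (sym (begin
    r                 ≡⟨ m<n⇒m%n≡m r<M ⟨
    r % M             ≡⟨ [m+kn]%n≡m%n r g M ⟨
    (r + g * M) % M   ≡⟨ cong (_% M) (+-comm r (g * M)) ⟩
    (g * M + r) % M   ≡⟨ n∣m⇒m%n≡0 _ M M∣ ⟩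
    0                 ∎))
    where open ≡-Reasoning

  toℕ-rot : (c : Fin M) → toℕ (rot c) ≡ suc (toℕ c) % M
  toℕ-rot c with m' ≟ toℕ c
  ... | yes m'≡c = trans (sym (n%n≡0 M)) (cong (λ y → suc y % M) m'≡c)
  ... | no  m'≢c = trans (toℕ-lower₁ (Fin.suc c) (λ e → m'≢c (suc-injective e)))
                         (sym (m<n⇒m%n≡m (s≤s (≤∧≢⇒< (≤-pred (toℕ<n c)) (m'≢c ∘ sym)))))

  toℕ-rot^ : ∀ j (c : Fin M) → toℕ (iterate rot c j) ≡ (toℕ c + j) % M
  toℕ-rot^ zero    c = sym (trans (cong (_% M) (+-identityʳ (toℕ c))) (m<n⇒m%n≡m (toℕ<n c)))
  toℕ-rot^ (suc j) c = begin
    toℕ (iterate rot (rot c) j)  ≡⟨ toℕ-rot^ j (rot c) ⟩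
    (toℕ (rot c) + j) % M        ≡⟨ cong (λ y → (y + j) % M) (toℕ-rot c) ⟩
    (suc (toℕ c) % M + j) % M    ≡⟨ %-+ˡ (suc (toℕ c)) j ⟩
    (suc (toℕ c) + j) % M        ≡⟨ cong (_% M) (+-suc (toℕ c) j) ⟨
    (toℕ c + suc j) % M          ∎
    where open ≡-Reasoning

  offset-rot : ∀ r (c : Fin M) → (r + toℕ (rot c)) % M ≡ suc ((r + toℕ c) % M) % M
  offset-rot r c = begin
    (r + toℕ (rot c)) % M          ≡⟨ cong (λ x → (r + x) % M) (toℕ-rot c) ⟩
    (r + suc (toℕ c) % M) % M      ≡⟨ cong (_% M) (+-comm r _) ⟩
    (suc (toℕ c) % M + r) % M      ≡⟨ %-+ˡ (suc (toℕ c)) r ⟩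
    (suc (toℕ c) + r) % M          ≡⟨ cong (λ x → suc x % M) (+-comm (toℕ c) r) ⟩
    suc (r + toℕ c) % M            ≡⟨ cong (_% M) (+-comm 1 (r + toℕ c)) ⟩
    (r + toℕ c + 1) % M            ≡⟨ %-+ˡ (r + toℕ c) 1 ⟨
    ((r + toℕ c) % M + 1) % M      ≡⟨ cong (_% M) (+-comm _ 1) ⟩
    suc ((r + toℕ c) % M) % M      ∎
    where open ≡-Reasoning

  rot^-period : (c : Fin M) → iterate rot c M ≡ c
  rot^-period c = toℕ-injective (trans (toℕ-rot^ M c) (trans ([m+n]%n≡m%n (toℕ c) M) (m<n⇒m%n≡m (toℕ<n c))))

  rot^-zero : (c : Fin M) → iterate rot Fin.zero (toℕ c) ≡ c
  rot^-zero c = toℕ-injective (trans (toℕ-rot^ (toℕ c) Fin.zero) (m<n⇒m%n≡m (toℕ<n c)))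

  ζ^-col : ∀ {n} j (i : Fin n) (c : Fin M) → iterate ζ (col i c) j ≡ col i (iterate rot c j)
  ζ^-col zero    i c = refl
  ζ^-col (suc j) i c = ζ^-col j i (rot c)

  ζ^-period : ∀ {n} (x : Pt n M) → iterate ζ x M ≡ x
  ζ^-period {n} origin = ζ^-origin M
    where ζ^-origin : ∀ j → iterate ζ (origin {n} {M}) j ≡ origin
          ζ^-origin zero    = refl
          ζ^-origin (suc j) = ζ^-origin j
  ζ^-period (col i c) = trans (ζ^-col M i c) (cong (col i) (rot^-period c))

hasColourIn : ∀ {n M} → (Pt n M → ℕ) → Fin n → ℕ → Bool
hasColourIn B i j = ⌊ any? (λ c → B (col i c) ≟ j) ⌋

hasColourIn-witness : ∀ {n M} (B : Pt n M → ℕ) {i j} → T (hasColourIn B i j) → ∃ λ c → B (col i c) ≡ j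
hasColourIn-witness B p = toWitness p

minBase : ∀ {n M} → (Pt n M → ℕ) → ℕ → ℕ
minBase B j = if ⌊ B origin ≟ j ⌋ then 0 else firstIdx (λ i → hasColourIn B i j)

module _ {n M : ℕ} (B : Pt n M → ℕ) where

  minBase-origin : ∀ {j} → B origin ≡ j → minBase B j ≡ 0
  minBase-origin {j} e = cong (if_then 0 else firstIdx (λ i → hasColourIn B i j)) (⌊⌋-true (B origin ≟ j) e)

  minBase-other : ∀ {j} → B origin ≢ j → minBase B j ≡ firstIdx (λ i → hasColourIn B i j)
  minBase-other {j} ne = cong (if_then 0 else firstIdx (λ i → hasColourIn B i j)) (⌊⌋-false (B origin ≟ j) ne)

  minBase-≤ : ∀ j → minBase B j ≤ n
  minBase-≤ j with ⌊ B origin ≟ j ⌋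
  ... | true  = z≤n
  ... | false = firstIdx-≤ _

minBase-cong : ∀ {n M} {B B′ : Pt n M → ℕ} → (∀ x → B x ≡ B′ x) → ∀ j → minBase B j ≡ minBase B′ j
minBase-cong {B = B} {B′} e j = cong₂ (λ b f → if b then 0 else f)
  (⌊⌋-⇔ (mk⇔ (trans (sym (e origin))) (trans (e origin))) (B origin ≟ j) (B′ origin ≟ j))
  (firstIdx-cong (λ i → ⌊⌋-⇔ (mk⇔ (λ (c , p) → c , trans (sym (e (col i c))) p) (λ (c , p) → c , trans (e (col i c)) p))
                  (any? (λ c → B (col i c) ≟ j)) (any? (λ c → B′ (col i c) ≟ j))))

minb-toℕ : ∀ {n M K} (blk : Pt n M → Fin K) l → minb blk l ≡ minBase (toℕ ∘ blk) (toℕ l)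
minb-toℕ blk l with blk origin Fin.≟ l
... | yes o≡l = sym (minBase-origin (toℕ ∘ blk) (cong toℕ o≡l))
... | no  o≢l = trans (firstIdx-cong (λ i → ⌊⌋-⇔ (mk⇔ (λ (c , p) → c , cong toℕ p) (λ (c , p) → c , toℕ-injective p))
                                                (any? (λ c → blk (col i c) Fin.≟ l)) (any? (λ c → toℕ (blk (col i c)) ≟ toℕ l))))
                      (sym (minBase-other (toℕ ∘ blk) (o≢l ∘ toℕ-injective)))

module Blocks {m' n : ℕ} (ω : OSSP (suc m') n) where
  open OSSP ω public using (k; start; start-ok)
  open OSSP ω using (blk; nonempty; zero∈S₀; S₀-closed; shift)

  M : ℕ
  M = suc m'

  #blocks : ℕ
  #blocks = suc (k * M)

  block : Pt n M → ℕ
  block = toℕ ∘ blk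

  block<#blocks : ∀ x → block x < #blocks
  block<#blocks x = toℕ<n (blk x)

  block-origin : block origin ≡ 0
  block-origin = cong toℕ zero∈S₀

  block-ζ : ∀ l → 1 ≤ l → l < k * M → ¬ (M ∣ l) → ∀ x → block x ≡ l → block (ζ x) ≡ suc l
  block-ζ l 1≤l l<kM M∤l x = Equivalence.to (shift l 1≤l l<kM M∤l x)

  block-ζ⁻¹ : ∀ l → 1 ≤ l → l < k * M → ¬ (M ∣ l) → ∀ x → block (ζ x) ≡ suc l → block x ≡ l
  block-ζ⁻¹ l 1≤l l<kM M∤l x = Equivalence.from (shift l 1≤l l<kM M∤l x)

  zeroBlock-closed : ∀ i c d → block (col i c) ≡ 0 → block (col i d) ≡ 0
  zeroBlock-closed i c d e = cong toℕ (S₀-closed i c d (toℕ-injective e))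

  block-ζ-nonzero : ∀ x → block x ≢ 0 → block (ζ x) ≢ 0
  block-ζ-nonzero origin    x≢0 _ = x≢0 block-origin
  block-ζ-nonzero (col i c) x≢0 e = x≢0 (zeroBlock-closed i (rot c) c e)

  block-ζ^ : ∀ {g} y → block y ≡ suc (g * M) → g < k → ∀ j → j < M → block (iterate ζ y j) ≡ suc (g * M + j)
  block-ζ^ {g} y e g<k zero    _     = trans e (cong suc (sym (+-identityʳ _)))
  block-ζ^ {g} y e g<k (suc j) sj<M = begin
    block (iterate ζ y (suc j))   ≡⟨ cong block (iterate-suc ζ y j) ⟩
    block (ζ (iterate ζ y j))     ≡⟨ block-ζ (suc (g * M + j)) (s≤s z≤n) l<kM M∤l (iterate ζ y j)
                                              (block-ζ^ y e g<k j (<-trans (n<1+n j) sj<M)) ⟩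
    suc (suc (g * M + j))         ≡⟨ cong suc (+-suc (g * M) j) ⟨
    suc (g * M + suc j)           ∎
    where
    open ≡-Reasoning
    l<kM : suc (g * M + j) < k * M
    l<kM = subst (_< k * M) (+-suc (g * M) j) (g<k∧r<M⇒g*M+r<k*M g<k sj<M)
    M∤l : ¬ (M ∣ suc (g * M + j))
    M∤l = subst (¬_ ∘ (M ∣_)) (+-suc (g * M) j) (0<r<M⇒M∤g*M+r g (s≤s z≤n) sj<M)

  -- ζ x begins the group of x; M ∸ 1 shifts lead from ζ x to ζ^M x = x.
  block-ζ-wrap : ∀ x → M ∣ block x → block x ≢ 0 → block (ζ x) + M ≡ suc (block x)
  block-ζ-wrap x M∣x x≢0 with block (ζ x) in eq
  ... | zero  = ⊥-elim (block-ζ-nonzero x x≢0 eq)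
  ... | suc a with M ∣? a
  ...   | no M∤a = ⊥-elim (M∤a (subst (M ∣_) (block-ζ⁻¹ a 1≤a a<kM M∤a x eq) M∣x))
    where
    1≤a : 1 ≤ a
    1≤a = n≢0⇒n>0 (λ a≡0 → M∤a (subst (M ∣_) (sym a≡0) (M ∣0)))
    a<kM : a < k * M
    a<kM = ≤-pred (subst (_< #blocks) eq (block<#blocks (ζ x)))
  ...   | yes (divides g refl) = begin
    suc (g * M) + M        ≡⟨ cong suc (+-suc (g * M) m') ⟩
    suc (suc (g * M + m')) ≡⟨ cong suc (block-ζ^ (ζ x) eq g<k m' ≤-refl) ⟨
    suc (block (iterate ζ (ζ x) m'))  ≡⟨ cong (suc ∘ block) (ζ^-period x) ⟩
    suc (block x)          ∎
    where
    open ≡-Reasoning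
    g<k : g < k
    g<k = *-cancelʳ-< M g k (≤-pred (subst (_< #blocks) eq (block<#blocks (ζ x))))

  sameBlock-ζ : ∀ x y → block x ≡ block y → block x ≢ 0 → block (ζ x) ≡ block (ζ y)
  sameBlock-ζ x y x≡y x≢0 with M ∣? block x
  ... | yes M∣x = +-cancelʳ-≡ M _ _ (trans (block-ζ-wrap x M∣x x≢0)
                    (trans (cong suc x≡y) (sym (block-ζ-wrap y (subst (M ∣_) x≡y M∣x) (x≢0 ∘ trans x≡y)))))
  ... | no M∤x with block x <? k * M
  ...   | yes x<kM = trans (block-ζ (block x) (n≢0⇒n>0 x≢0) x<kM M∤x x refl)
                           (sym (block-ζ (block x) (n≢0⇒n>0 x≢0) x<kM M∤x y (sym x≡y)))
  ...   | no  x≮kM = ⊥-elim (M∤x (subst (M ∣_) (sym (≤-antisym (≤-pred (block<#blocks x)) (≮⇒≥ x≮kM))) (n∣m*n k)))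

  sameBlock-ζ^ : ∀ j x y → block x ≡ block y → block x ≢ 0 → block (iterate ζ x j) ≡ block (iterate ζ y j)
  sameBlock-ζ^ zero    x y x≡y x≢0 = x≡y
  sameBlock-ζ^ (suc j) x y x≡y x≢0 = sameBlock-ζ^ j (ζ x) (ζ y) (sameBlock-ζ x y x≡y x≢0) (block-ζ-nonzero x x≢0)

  sameBlock-colour : ∀ v d i c → block (col v d) ≡ block (col i Fin.zero) → block (col i Fin.zero) ≢ 0 →
                     ∃ λ d′ → block (col v d′) ≡ block (col i c)
  sameBlock-colour v d i c v≡i i≢0 = iterate rot d (toℕ c) , (begin
    block (col v (iterate rot d (toℕ c)))          ≡⟨ cong block (ζ^-col (toℕ c) v d) ⟨
    block (iterate ζ (col v d) (toℕ c))            ≡⟨ sameBlock-ζ^ (toℕ c) (col i Fin.zero) (col v d) (sym v≡i) i≢0 ⟨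
    block (iterate ζ (col i Fin.zero) (toℕ c))     ≡⟨ cong block (trans (ζ^-col (toℕ c) i Fin.zero) (cong (col i) (rot^-zero c))) ⟩
    block (col i c)                                ∎)
    where open ≡-Reasoning

  minBase′ : ℕ → ℕ
  minBase′ = minBase block

  minBase′-pos : ∀ j → 1 ≤ j → minBase′ j ≡ firstIdx (λ i → hasColourIn block i j)
  minBase′-pos j 1≤j = minBase-other block (λ o≡j → <⇒≢ 1≤j (trans (sym block-origin) o≡j))

  minBase′-witness : ∀ j → 1 ≤ j → j < #blocks → ∃ λ v → minBase′ j ≡ suc (toℕ v) × T (hasColourIn block v j)
  minBase′-witness j 1≤j j<K with nonempty (fromℕ< j<K)
  ... | origin , e = ⊥-elim (<⇒≢ 1≤j (trans (sym block-origin) (trans (cong toℕ e) (toℕ-fromℕ< j<K))))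
  ... | col i c , e with firstIdx-witness (λ i → hasColourIn block i j) i (fromWitness (c , trans (cong toℕ e) (toℕ-fromℕ< j<K)))
  ...   | v , fv , hv = v , trans (minBase′-pos j 1≤j) fv , hv

+a≤+X-+c⇔a+c≤X : ∀ a X c → (ℤ.+ a ℤ.≤ ℤ.+ X ℤ.- ℤ.+ c) ⇔ (a + c ≤ X)
+a≤+X-+c⇔a+c≤X a X c rewrite m-n≡m⊖n X c with c ≤? X
... | yes c≤X rewrite ⊖-≥ c≤X = mk⇔
  (λ a≤X∸c → subst (a + c ≤_) (m∸n+n≡m c≤X) (+-monoˡ-≤ c (drop‿+≤+ a≤X∸c)))
  (λ a+c≤X → ℤ.+≤+ (m+n≤o⇒m≤o∸n a a+c≤X))
... | no  c≰X rewrite ⊖-< (≰⇒> c≰X) = mk⇔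
  (λ a≤neg → ⊥-elim (+≰neg (m<n⇒0<n∸m (≰⇒> c≰X)) a≤neg))
  (λ a+c≤X → ⊥-elim (c≰X (≤-trans (m≤n+m c a) a+c≤X)))
  where
  +≰neg : ∀ {e} → 0 < e → ¬ (ℤ.+ a ℤ.≤ ℤ.- ℤ.+ e)
  +≰neg {suc e} _ ()

∈?-lookup : ∀ {n} (u : Fin n) (S : Subset n) → ⌊ u ∈? S ⌋ ≡ lookup S u
∈?-lookup Fin.zero    (true  ∷ S) = refl
∈?-lookup Fin.zero    (false ∷ S) = refl
∈?-lookup (Fin.suc u) (_ ∷ S)     = trans (isYes≗does (Fin.suc u ∈? (_ ∷ S))) (trans (sym (isYes≗does (u ∈? S))) (∈?-lookup u S))

#outside≤ : ∀ {n} → (Fin n → Bool) → Fin n → ℕ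
#outside≤ inT t = countF (λ u → not (inT u) ∧ ⌊ toℕ u ≤? toℕ t ⌋)

-- α_t ≤ β(T)_t with the subtraction in β moved to the left; outside is the number of u ≤ t with u ∉ T.
WithinBeta : (M outside : ℕ) → Bool → ℕ → Set
WithinBeta M outside true  a = a + 2 ≤ suc outside * M
WithinBeta M outside false a = a + 1 ≤ outside * M

≤β⇔WithinBeta : ∀ {n} M (T : Subset n) t a → (ℤ.+ a ℤ.≤ β M T t) ⇔ WithinBeta M (#outside≤ (lookup T) t) (lookup T t) a
≤β⇔WithinBeta M T t a
  rewrite ∈?-lookup t T
        | countF-cong (λ u → cong (λ b → not b ∧ ⌊ toℕ u ≤? toℕ t ⌋) (∈?-lookup u T))
  with lookup T t
... | true  = +a≤+X-+c⇔a+c≤X a _ 2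
... | false = +a≤+X-+c⇔a+c≤X a _ 1

module _ {m' : ℕ} where
  private M = suc m'

  -- In the order i^s, i^{s+1}, … colour d sits at position (d + M ∸ s) mod M, so exactly the
  -- colours 1, …, s ∸ 1 come after colour 0.
  #after-colour0 : (s : Fin M) → s ≢ Fin.zero →
    countF (λ (d : Fin M) → ⌊ (0 + (M ∸ toℕ s)) % M <? (toℕ d + (M ∸ toℕ s)) % M ⌋) ≡ toℕ s ∸ 1
  #after-colour0 s s≢0 = begin
    countF {M} (λ d → ⌊ (0 + w) % M <? (toℕ d + w) % M ⌋)   ≡⟨ countF-toℕ M (λ d → ⌊ (0 + w) % M <? (d + w) % M ⌋) ⟩
    count M (λ d → ⌊ (0 + w) % M <? (d + w) % M ⌋)      ≡⟨ cong (λ K → count K after) (m+[n∸m]≡n (<⇒≤ s<M)) ⟨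
    count (toℕ s + w) after                             ≡⟨ count-+ (toℕ s) w after ⟩
    count (toℕ s) after + count w (after ∘ (toℕ s +_))  ≡⟨ cong₂ _+_ before-s from-s ⟩
    toℕ s ∸ 1 + 0                                       ≡⟨ +-identityʳ _ ⟩
    toℕ s ∸ 1                                           ∎
    where
    open ≡-Reasoning
    w = M ∸ toℕ s
    after : ℕ → Bool
    after d = ⌊ (0 + w) % M <? (d + w) % M ⌋
    s<M : toℕ s < M
    s<M = toℕ<n s
    0<s : 0 < toℕ s
    0<s = n≢0⇒n>0 (s≢0 ∘ toℕ-injective)
    w<M : w < M
    w<M = ∸-monoʳ-< 0<s (<⇒≤ s<M)
    before-s : count (toℕ s) after ≡ toℕ s ∸ 1
    before-s = trans (count-cong (toℕ s) (λ d d<s → ⌊⌋-⇔ (mk⇔ (from-pos d d<s) (to-pos d d<s)) _ (0 <? d))) (count-> (toℕ s) 0)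
      where
      d+w<M : ∀ d → d < toℕ s → d + w < M
      d+w<M d d<s = subst (d + w <_) (m+[n∸m]≡n (<⇒≤ s<M)) (+-monoˡ-< w d<s)
      from-pos : ∀ d → d < toℕ s → (0 + w) % M < (d + w) % M → 0 < d
      from-pos zero    _ w<w = ⊥-elim (<-irrefl refl w<w)
      from-pos (suc d) _ _   = s≤s z≤n
      to-pos : ∀ d → d < toℕ s → 0 < d → (0 + w) % M < (d + w) % M
      to-pos d d<s 0<d = subst₂ _<_ (sym (m<n⇒m%n≡m w<M)) (sym (m<n⇒m%n≡m (d+w<M d d<s))) (m<n+m w 0<d)
    from-s : count w (after ∘ (toℕ s +_)) ≡ 0
    from-s = count-none w (λ e e<w p → <⇒≱ (subst (_< w) (sym (wrap e e<w)) e<w)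
                                          (<⇒≤ (subst (_< (toℕ s + e + w) % M) (m<n⇒m%n≡m w<M) (toWitness p))))
      where
      wrap : ∀ e → e < w → (toℕ s + e + w) % M ≡ e
      wrap e e<w = begin
        (toℕ s + e + w) % M   ≡⟨ cong (_% M) (trans (+-assoc (toℕ s) e w) (x∙yz≈y∙xz (toℕ s) e w)) ⟩
        (e + (toℕ s + w)) % M ≡⟨ cong (λ y → (e + y) % M) (m+[n∸m]≡n (<⇒≤ s<M)) ⟩
        (e + M) % M           ≡⟨ [m+n]%n≡m%n e M ⟩
        e % M                 ≡⟨ m<n⇒m%n≡m (<-trans e<w w<M) ⟩
        e                     ∎

module InversionBound {m' n : ℕ} (ω : OSSP (suc m') n) where
  open Blocks ω

  inT : Fin n → Bool
  inT u = ⌊ minBase′ (block (col u Fin.zero)) <? suc (toℕ u) ⌋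

  lookup-Tω : ∀ u → lookup (Tω ω) u ≡ inT u
  lookup-Tω u = trans (lookup∘tabulate _ u) (cong (λ b → ⌊ b <? suc (toℕ u) ⌋) (minb-toℕ (OSSP.blk ω) (OSSP.blk ω (col u c0))))

  #blocksMinBase≤ : ℕ → ℕ
  #blocksMinBase≤ b = count #blocks (λ j → ⌊ 1 ≤? j ⌋ ∧ ⌊ minBase′ j ≤? b ⌋)

  #blocksMinBase≡ : ℕ → ℕ
  #blocksMinBase≡ b = count #blocks (λ j → ⌊ 1 ≤? j ⌋ ∧ ⌊ minBase′ j ≟ b ⌋)

  -- The least base v of the block of i^0 also meets every block that contains a colour of i.
  minBase′-nonleading : ∀ i c j → T (inT i) → block (col i c) ≡ j → 1 ≤ j → minBase′ j < suc (toℕ i)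
  minBase′-nonleading i c j i∈T ic≡j 1≤j = begin-strict
    minBase′ j                ≤⟨ subst (_≤ suc (toℕ v)) (sym (minBase′-pos j 1≤j)) (firstIdx-≤-suc _ v (fromWitness v∈j)) ⟩
    suc (toℕ v)               ≡⟨ mbJ≡v ⟨
    minBase′ J                <⟨ toWitness i∈T ⟩
    suc (toℕ i)               ∎
    where
    open ≤-Reasoning hiding (start)
    J = block (col i Fin.zero)
    J≢0 : J ≢ 0
    J≢0 J≡0 = <⇒≢ 1≤j (sym (trans (sym ic≡j) (zeroBlock-closed i Fin.zero c J≡0)))
    witness = minBase′-witness J (n≢0⇒n>0 J≢0) (block<#blocks _)
    v = proj₁ witness
    mbJ≡v : minBase′ J ≡ suc (toℕ v)
    mbJ≡v = proj₁ (proj₂ witness)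
    v∈J : ∃ λ d → block (col v d) ≡ J
    v∈J = toWitness (proj₂ (proj₂ witness))
    v∈j : ∃ λ d → block (col v d) ≡ j
    v∈j = let (d , e) = sameBlock-colour v (proj₁ v∈J) i c (proj₂ v∈J) J≢0 in d , trans e ic≡j

  hasColour-minBase≡ : ∀ i j → j < #blocks → 1 ≤ j → minBase′ j ≡ suc (toℕ i) → T (hasColourIn block i j)
  hasColour-minBase≡ i j j<K 1≤j mb≡i with minBase′-witness j 1≤j j<K
  ... | v , mb≡v , v∈j = subst (λ u → T (hasColourIn block u j)) (toℕ-injective (suc-injective (trans (sym mb≡v) mb≡i))) v∈j

  #blocksMinBase≡-bound : ∀ i → #blocksMinBase≡ (suc (toℕ i)) ≤ M * indicator (not (inT i))
  #blocksMinBase≡-bound i with inT i in eq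
  ... | false = begin
    #blocksMinBase≡ (suc (toℕ i))
      ≤⟨ count-mono #blocks (λ j j<K p → let (1≤j , mb≡i) = T-⌊⌋∧⌊⌋ (1 ≤? j) (minBase′ j ≟ _) p
                                          in hasColour-minBase≡ i j j<K 1≤j mb≡i) ⟩
    count #blocks (λ j → hasColourIn block i j)  ≤⟨ count-image #blocks (λ c → block (col i c)) ⟩
    M                                           ≡⟨ *-identityʳ M ⟨
    M * 1                                       ∎
    where open ≤-Reasoning
  ... | true = ≤-reflexive (trans (count-none #blocks nonleading) (sym (*-zeroʳ M)))
    where
    nonleading : ∀ j → j < #blocks → ¬ T (⌊ 1 ≤? j ⌋ ∧ ⌊ minBase′ j ≟ suc (toℕ i) ⌋)
    nonleading j j<K p = <-irrefl mb≡i (minBase′-nonleading i c j (subst T (sym eq) _) ic≡j 1≤j)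
      where
      1≤j×mb≡i = T-⌊⌋∧⌊⌋ (1 ≤? j) (minBase′ j ≟ suc (toℕ i)) p
      1≤j = proj₁ 1≤j×mb≡i
      mb≡i = proj₂ 1≤j×mb≡i
      c×ic≡j = toWitness (hasColour-minBase≡ i j j<K 1≤j mb≡i)
      c = proj₁ c×ic≡j
      ic≡j = proj₂ c×ic≡j

  leading : ℕ → Bool
  leading = extendByFalse (not ∘ inT)

  #blocksMinBase≤-bound : ∀ b → b ≤ n → #blocksMinBase≤ b ≤ M * count b leading
  #blocksMinBase≤-bound zero _ = ≤-reflexive (trans (count-none #blocks noBlock) (sym (*-zeroʳ M)))
    where
    noBlock : ∀ j → j < #blocks → ¬ T (⌊ 1 ≤? j ⌋ ∧ ⌊ minBase′ j ≤? 0 ⌋)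
    noBlock j j<K p with T-⌊⌋∧⌊⌋ (1 ≤? j) (minBase′ j ≤? 0) p
    ... | 1≤j , mb≤0 with minBase′-witness j 1≤j j<K
    ...   | v , mb≡v , _ = n≮0 (subst (_≤ 0) mb≡v mb≤0)
  #blocksMinBase≤-bound (suc b) b<n = begin
    #blocksMinBase≤ (suc b)
      ≤⟨ count-mono #blocks (λ j _ → split j) ⟩
    count #blocks (λ j → (⌊ 1 ≤? j ⌋ ∧ ⌊ minBase′ j ≤? b ⌋) ∨ (⌊ 1 ≤? j ⌋ ∧ ⌊ minBase′ j ≟ suc b ⌋))
      ≤⟨ count-∨ #blocks (λ j → ⌊ 1 ≤? j ⌋ ∧ ⌊ minBase′ j ≤? b ⌋) (λ j → ⌊ 1 ≤? j ⌋ ∧ ⌊ minBase′ j ≟ suc b ⌋) ⟩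
    #blocksMinBase≤ b + #blocksMinBase≡ (suc b)
      ≤⟨ +-mono-≤ (#blocksMinBase≤-bound b (<⇒≤ b<n)) last ⟩
    M * count b leading + M * indicator (leading b)
      ≡⟨ *-distribˡ-+ M (count b leading) _ ⟨
    M * (count b leading + indicator (leading b))
      ≡⟨ cong (M *_) (count-snoc b leading) ⟨
    M * count (suc b) leading ∎
    where
    open ≤-Reasoning hiding (start)
    i : Fin n
    i = Fin.fromℕ< b<n
    last : #blocksMinBase≡ (suc b) ≤ M * indicator (leading b)
    last = subst (λ b → #blocksMinBase≡ (suc b) ≤ M * indicator (leading b)) (toℕ-fromℕ< b<n)
             (subst (λ l → #blocksMinBase≡ (suc (toℕ i)) ≤ M * indicator l) (sym (extendByFalse-toℕ (not ∘ inT) i))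
               (#blocksMinBase≡-bound i))
    split : ∀ j → T (⌊ 1 ≤? j ⌋ ∧ ⌊ minBase′ j ≤? suc b ⌋) →
            T ((⌊ 1 ≤? j ⌋ ∧ ⌊ minBase′ j ≤? b ⌋) ∨ (⌊ 1 ≤? j ⌋ ∧ ⌊ minBase′ j ≟ suc b ⌋))
    split j p with T-⌊⌋∧⌊⌋ (1 ≤? j) (minBase′ j ≤? suc b) p
    ... | 1≤j , mb≤sb with m≤n⇒m<n∨m≡n mb≤sb
    ...   | inj₁ mb<sb = from T-∨ (inj₁ (⌊⌋∧⌊⌋-T (1 ≤? j) (minBase′ j ≤? b) 1≤j (≤-pred mb<sb)))
    ...   | inj₂ mb≡sb = from T-∨ (inj₂ (⌊⌋∧⌊⌋-T (1 ≤? j) (minBase′ j ≟ suc b) 1≤j mb≡sb))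

  #laterBlocks : Fin n → ℕ
  #laterBlocks t = count #blocks (λ j → ⌊ block (col t Fin.zero) <? j ⌋ ∧ ⌊ minBase′ j ≤? suc (toℕ t) ⌋)

  inv₁≡#laterBlocks : ∀ t → inv₁ ω t ≡ #laterBlocks t
  inv₁≡#laterBlocks t = trans
    (countF-cong (λ l → cong (λ b → ⌊ block (col t Fin.zero) <? toℕ l ⌋ ∧ ⌊ b ≤? suc (toℕ t) ⌋) (minb-toℕ (OSSP.blk ω) l)))
    (countF-toℕ #blocks (λ j → ⌊ block (col t Fin.zero) <? j ⌋ ∧ ⌊ minBase′ j ≤? suc (toℕ t) ⌋))

  #laterBlocks≤#blocksMinBase≤ : ∀ t → #laterBlocks t ≤ #blocksMinBase≤ (suc (toℕ t))
  #laterBlocks≤#blocksMinBase≤ t = count-mono #blocks λ j _ p →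
    let (b<j , mb≤t) = T-⌊⌋∧⌊⌋ (block (col t Fin.zero) <? j) (minBase′ j ≤? suc (toℕ t)) p
    in ⌊⌋∧⌊⌋-T (1 ≤? j) (minBase′ j ≤? suc (toℕ t)) (≤-trans (s≤s z≤n) b<j) mb≤t

  -- The block of t^0 itself is counted on the right but not on the left.
  #laterBlocks<#blocksMinBase≤ : ∀ t → block (col t Fin.zero) ≢ 0 → #laterBlocks t < #blocksMinBase≤ (suc (toℕ t))
  #laterBlocks<#blocksMinBase≤ t b≢0 = count-mono-< #blocks
    (λ j _ p → let (b<j , mb≤t) = T-⌊⌋∧⌊⌋ (b <? j) (minBase′ j ≤? suc (toℕ t)) p
               in ⌊⌋∧⌊⌋-T (1 ≤? j) (minBase′ j ≤? suc (toℕ t)) (≤-trans (s≤s z≤n) b<j) mb≤t)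
    b (block<#blocks _)
    (λ p → <-irrefl refl (proj₁ (T-⌊⌋∧⌊⌋ (b <? b) (minBase′ b ≤? suc (toℕ t)) p)))
    (⌊⌋∧⌊⌋-T (1 ≤? b) (minBase′ b ≤? suc (toℕ t)) (n≢0⇒n>0 b≢0)
      (subst (_≤ suc (toℕ t)) (sym (minBase′-pos b (n≢0⇒n>0 b≢0))) (firstIdx-≤-suc _ t (fromWitness (Fin.zero , refl)))))
    where b = block (col t Fin.zero)

  inv₂-zeroBlock : ∀ t → block (col t Fin.zero) ≡ 0 → inv₂ ω t ≡ toℕ (start t) ∸ 1
  inv₂-zeroBlock t t∈S₀ = trans
    (countF-cong (λ d → cong₂ (λ b₀ b_d → b₀ ∧ b_d ∧ ⌊ pos ω t c0 <? pos ω t d ⌋)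
      (⌊⌋-true (blk (col t c0) Fin.≟ Fin.zero) (toℕ-injective t∈S₀))
      (⌊⌋-true (blk (col t d) Fin.≟ Fin.zero) (toℕ-injective (zeroBlock-closed t Fin.zero d t∈S₀)))))
    (#after-colour0 (start t) (start-ok t (toℕ-injective t∈S₀)))
    where open OSSP ω using (blk)

  inv₂-nonzeroBlock : ∀ t → block (col t Fin.zero) ≢ 0 → inv₂ ω t ≡ 0
  inv₂-nonzeroBlock t t∉S₀ = trans
    (countF-cong (λ d → cong (λ b₀ → b₀ ∧ ⌊ blk (col t d) Fin.≟ Fin.zero ⌋ ∧ ⌊ pos ω t c0 <? pos ω t d ⌋)
      (⌊⌋-false (blk (col t c0) Fin.≟ Fin.zero) (t∉S₀ ∘ cong toℕ))))
    (countF-none {M} (λ _ → false) (λ _ ()))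
    where open OSSP ω using (blk)

  lookup-η : ∀ t → lookup (η ω) t ≡ #laterBlocks t + inv₂ ω t
  lookup-η t = trans (lookup∘tabulate _ t) (cong (_+ inv₂ ω t) (inv₁≡#laterBlocks t))

  #leading≤ : Fin n → ℕ
  #leading≤ t = count (suc (toℕ t)) leading

  #laterBlocks≤M*#leading≤ : ∀ t → #laterBlocks t ≤ M * #leading≤ t
  #laterBlocks≤M*#leading≤ t = ≤-trans (#laterBlocks≤#blocksMinBase≤ t) (#blocksMinBase≤-bound (suc (toℕ t)) (toℕ<n t))

  #laterBlocks<M*#leading≤ : ∀ t → block (col t Fin.zero) ≢ 0 → #laterBlocks t < M * #leading≤ t
  #laterBlocks<M*#leading≤ t b≢0 = <-≤-trans (#laterBlocks<#blocksMinBase≤ t b≢0) (#blocksMinBase≤-bound (suc (toℕ t)) (toℕ<n t))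

  η+2≤-zeroBlock : ∀ t → block (col t Fin.zero) ≡ 0 → lookup (η ω) t + 2 ≤ suc (#leading≤ t) * M
  η+2≤-zeroBlock t t∈S₀ = begin
    lookup (η ω) t + 2     ≡⟨ cong (_+ 2) (trans (lookup-η t) (cong (L +_) (inv₂-zeroBlock t t∈S₀))) ⟩
    L + (s ∸ 1) + 2        ≡⟨ trans (+-assoc L (s ∸ 1) 2) (cong (L +_) (+-suc (s ∸ 1) 1)) ⟩
    L + suc (s ∸ 1 + 1)    ≡⟨ cong (λ x → L + suc x) (m∸n+n≡m 1≤s) ⟩
    L + suc s              ≤⟨ +-mono-≤ (#laterBlocks≤M*#leading≤ t) (s≤s (≤-pred (toℕ<n (start t)))) ⟩
    M * #leading≤ t + M    ≡⟨ trans (+-comm _ M) (cong (M +_) (*-comm M _)) ⟩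
    suc (#leading≤ t) * M  ∎
    where
    open ≤-Reasoning hiding (start)
    L = #laterBlocks t
    s = toℕ (start t)
    1≤s : 1 ≤ s
    1≤s = n≢0⇒n>0 (start-ok t (toℕ-injective t∈S₀) ∘ toℕ-injective)

  η+1≤-nonzeroBlock : ∀ t → block (col t Fin.zero) ≢ 0 → lookup (η ω) t + 1 ≤ #leading≤ t * M
  η+1≤-nonzeroBlock t t∉S₀ = begin
    lookup (η ω) t + 1     ≡⟨ cong (_+ 1) (trans (lookup-η t) (trans (cong (L +_) (inv₂-nonzeroBlock t t∉S₀)) (+-identityʳ L))) ⟩
    L + 1                  ≡⟨ +-comm L 1 ⟩
    suc L                  ≤⟨ #laterBlocks<M*#leading≤ t t∉S₀ ⟩
    M * #leading≤ t        ≡⟨ *-comm M _ ⟩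
    #leading≤ t * M        ∎
    where
    open ≤-Reasoning hiding (start)
    L = #laterBlocks t

  η-withinBeta : ∀ t → WithinBeta M (#leading≤ t) (inT t) (lookup (η ω) t)
  η-withinBeta t with inT t in eq | block (col t Fin.zero) ≟ 0
  ... | true  | yes t∈S₀ = η+2≤-zeroBlock t t∈S₀
  ... | true  | no  t∉S₀ = begin
    lookup (η ω) t + 2        ≡⟨ +-assoc (lookup (η ω) t) 1 1 ⟨
    lookup (η ω) t + 1 + 1    ≤⟨ +-mono-≤ (η+1≤-nonzeroBlock t t∉S₀) (s≤s z≤n) ⟩
    #leading≤ t * M + M       ≡⟨ +-comm _ M ⟩
    suc (#leading≤ t) * M     ∎
    where open ≤-Reasoning hiding (start)
  ... | false | no  t∉S₀ = η+1≤-nonzeroBlock t t∉S₀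
  ... | false | yes t∈S₀ = ⊥-elim (subst T eq (fromWitness {a? = minBase′ (block (col t Fin.zero)) <? suc (toℕ t)}
                             (subst (_< suc (toℕ t)) (sym (trans (cong minBase′ t∈S₀) (minBase-origin block block-origin))) (s≤s z≤n))))

  #outside≤-Tω : ∀ t → #outside≤ (lookup (Tω ω)) t ≡ #leading≤ t
  #outside≤-Tω t = trans (countF-cong (λ u → cong (λ b → not b ∧ ⌊ toℕ u ≤? toℕ t ⌋) (lookup-Tω u)))
                         (countF-≤ (not ∘ inT) (toℕ t))

  η-∈SA : (η ω , Tω ω) ∈SA[ M ]
  η-∈SA t = from (≤β⇔WithinBeta M (Tω ω) t (lookup (η ω) t))
                 (subst₂ (λ c b → WithinBeta M c b (lookup (η ω) t)) (sym (#outside≤-Tω t)) (sym (lookup-Tω t)) (η-withinBeta t))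

infixl 5 _∷ʳ_
_∷ʳ_ : ∀ {a} {A : Set a} {n} → (Fin n → A) → A → Fin (suc n) → A
_∷ʳ_ {n = zero}  f x Fin.zero    = x
_∷ʳ_ {n = suc n} f x Fin.zero    = f Fin.zero
_∷ʳ_ {n = suc n} f x (Fin.suc i) = ((f ∘ Fin.suc) ∷ʳ x) i

∷ʳ-inject₁ : ∀ {a} {A : Set a} {n} (f : Fin n → A) x i → (f ∷ʳ x) (inject₁ i) ≡ f i
∷ʳ-inject₁ f x Fin.zero    = refl
∷ʳ-inject₁ f x (Fin.suc i) = ∷ʳ-inject₁ (f ∘ Fin.suc) x i

∷ʳ-fromℕ : ∀ {a} {A : Set a} {n} (f : Fin n → A) x → (f ∷ʳ x) (fromℕ n) ≡ x
∷ʳ-fromℕ {n = zero}  f x = refl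
∷ʳ-fromℕ {n = suc n} f x = ∷ʳ-fromℕ (f ∘ Fin.suc) x

-- An ordered super set partition with block indices in ℕ, so that blocks can be renumbered arithmetically.
record BlockMap (m' n : ℕ) : Set where
  field
    k                : ℕ
    block            : Pt n (suc m') → ℕ
    block<           : ∀ x → block x < suc (k * suc m')
    surjective       : ∀ l → l < suc (k * suc m') → ∃ λ x → block x ≡ l
    origin∈0         : block origin ≡ 0
    zeroBlock-closed : ∀ i c d → block (col i c) ≡ 0 → block (col i d) ≡ 0
    shift            : ∀ l → 1 ≤ l → l < k * suc m' → ¬ (suc m' ∣ l) → ∀ x → (block x ≡ l) ⇔ (block (ζ x) ≡ suc l)
    start            : Fin n → Fin (suc m')
    start-ok         : ∀ i → block (col i Fin.zero) ≡ 0 → start i ≢ Fin.zero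

toOSSP : ∀ {m' n} → BlockMap m' n → OSSP (suc m') n
toOSSP B = record
  { k         = k
  ; blk       = blk
  ; nonempty  = λ l → let (x , e) = surjective (toℕ l) (toℕ<n l) in x , toℕ-injective (trans (toℕ-fromℕ< _) e)
  ; zero∈S₀   = toℕ-injective (trans (toℕ-fromℕ< _) origin∈0)
  ; S₀-closed = λ i c d e → toℕ-injective (trans (toℕ-fromℕ< _) (zeroBlock-closed i c d (trans (sym (toℕ-fromℕ< _)) (cong toℕ e))))
  ; shift     = λ l 1≤l l<kM M∤l x → mk⇔
      (λ e → trans (toℕ-fromℕ< _) (to (shift l 1≤l l<kM M∤l x) (trans (sym (toℕ-fromℕ< _)) e)))
      (λ e → trans (toℕ-fromℕ< _) (from (shift l 1≤l l<kM M∤l x) (trans (sym (toℕ-fromℕ< _)) e)))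
  ; start     = start
  ; start-ok  = λ i e → start-ok i (trans (sym (toℕ-fromℕ< _)) (cong toℕ e))
  }
  where
  open BlockMap B
  blk : Pt _ _ → Fin (suc (k * _))
  blk x = fromℕ< (block< x)

block-toOSSP : ∀ {m' n} (B : BlockMap m' n) x → Blocks.block (toOSSP B) x ≡ BlockMap.block B x
block-toOSSP B x = toℕ-fromℕ< (BlockMap.block< B x)

liftPt : ∀ {n M} → Pt n M → Pt (suc n) M
liftPt origin    = origin
liftPt (col i c) = col (inject₁ i) c

-- ω⁺ adds a largest base to ω: old blocks are renumbered by φ, colour c of the new base goes to block g c.
module Extension {m' n : ℕ} (ω : OSSP (suc m') n) (k⁺ : ℕ) (φ : ℕ → ℕ) (g : Fin (suc m') → ℕ) (newStart : Fin (suc m'))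
  (φ-injective  : ∀ a b → φ a ≡ φ b → a ≡ b)
  (φ-zero       : φ 0 ≡ 0)
  (φ<           : ∀ a → a < Blocks.#blocks ω → φ a < suc (k⁺ * suc m'))
  (g<           : ∀ c → g c < suc (k⁺ * suc m'))
  (φ-or-g       : ∀ l → l < suc (k⁺ * suc m') → (∃ λ a → a < Blocks.#blocks ω × φ a ≡ l) ⊎ (∃ λ c → g c ≡ l))
  (g-zeroBlock  : ∀ c d → g c ≡ 0 → g d ≡ 0)
  (φ-shift      : ∀ l → 1 ≤ l → l < k⁺ * suc m' → ¬ (suc m' ∣ l) → ∀ x →
                  (φ (Blocks.block ω x) ≡ l) ⇔ (φ (Blocks.block ω (ζ x)) ≡ suc l))
  (g-shift      : ∀ l → 1 ≤ l → l < k⁺ * suc m' → ¬ (suc m' ∣ l) → ∀ c → (g c ≡ l) ⇔ (g (rot c) ≡ suc l))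
  (newStart-ok  : g Fin.zero ≡ 0 → newStart ≢ Fin.zero)
  where
  open Blocks ω

  φ≡0 : ∀ a → φ a ≡ 0 → a ≡ 0
  φ≡0 a φa≡0 = φ-injective a 0 (trans φa≡0 (sym φ-zero))

  block⁺ : Pt (suc n) M → ℕ
  block⁺ origin    = 0
  block⁺ (col i c) = ((λ j → φ (block (col j c))) ∷ʳ g c) i

  block⁺-old : ∀ i c → block⁺ (col (inject₁ i) c) ≡ φ (block (col i c))
  block⁺-old i c = ∷ʳ-inject₁ (λ j → φ (block (col j c))) (g c) i

  block⁺-new : ∀ c → block⁺ (col (fromℕ n) c) ≡ g c
  block⁺-new c = ∷ʳ-fromℕ (λ j → φ (block (col j c))) (g c)

  block⁺-lift : ∀ x → block⁺ (liftPt x) ≡ φ (block x)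
  block⁺-lift origin    = trans (sym φ-zero) (cong φ (sym block-origin))
  block⁺-lift (col i c) = block⁺-old i c

  data Point⁺ : Pt (suc n) M → Set where
    origin⁺ : Point⁺ origin
    old     : ∀ x → Point⁺ (liftPt x)
    new     : ∀ c → Point⁺ (col (fromℕ n) c)

  point⁺ : ∀ x → Point⁺ x
  point⁺ origin = origin⁺
  point⁺ (col i c) with view i
  ... | ‵fromℕ  = new c
  ... | ‵inj₁ {i = j} _ = old (col j c)

  blockMap : BlockMap m' (suc n)
  blockMap = record
    { k                = k⁺
    ; block            = block⁺
    ; block<           = block⁺<
    ; surjective       = surjective
    ; origin∈0         = refl
    ; zeroBlock-closed = zeroBlock-closed⁺
    ; shift            = shift⁺
    ; start            = start ∷ʳ newStart
    ; start-ok         = start-ok⁺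
    }
    where
    block⁺< : ∀ x → block⁺ x < suc (k⁺ * M)
    block⁺< x with point⁺ x
    ... | origin⁺ = s≤s z≤n
    ... | old y   = subst (_< suc (k⁺ * M)) (sym (block⁺-lift y)) (φ< (block y) (block<#blocks y))
    ... | new c   = subst (_< suc (k⁺ * M)) (sym (block⁺-new c)) (g< c)

    surjective : ∀ l → l < suc (k⁺ * M) → ∃ λ x → block⁺ x ≡ l
    surjective l l<K with φ-or-g l l<K
    ... | inj₂ (c , gc≡l) = col (fromℕ n) c , trans (block⁺-new c) gc≡l
    ... | inj₁ (a , a<K , φa≡l) with OSSP.nonempty ω (fromℕ< a<K)
    ...   | y , e = liftPt y , trans (block⁺-lift y) (trans (cong φ (trans (cong toℕ e) (toℕ-fromℕ< a<K))) φa≡l)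

    zeroBlock-closed⁺ : ∀ i c d → block⁺ (col i c) ≡ 0 → block⁺ (col i d) ≡ 0
    zeroBlock-closed⁺ i c d e with view i
    ... | ‵fromℕ = trans (block⁺-new d) (g-zeroBlock c d (trans (sym (block⁺-new c)) e))
    ... | ‵inj₁ {i = j} _ = trans (block⁺-old j d)
            (trans (cong φ (zeroBlock-closed j c d (φ≡0 _ (trans (sym (block⁺-old j c)) e)))) φ-zero)

    shift⁺ : ∀ l → 1 ≤ l → l < k⁺ * M → ¬ (M ∣ l) → ∀ x → (block⁺ x ≡ l) ⇔ (block⁺ (ζ x) ≡ suc l)
    shift⁺ l 1≤l l<kM M∤l x with point⁺ x
    ... | origin⁺ = mk⇔ (λ 0≡l → ⊥-elim (<⇒≢ 1≤l 0≡l)) (λ ())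
    ... | old (col j c) = mk⇔
      (λ e → trans (block⁺-old j (rot c)) (to (φ-shift l 1≤l l<kM M∤l (col j c)) (trans (sym (block⁺-old j c)) e)))
      (λ e → trans (block⁺-old j c) (from (φ-shift l 1≤l l<kM M∤l (col j c)) (trans (sym (block⁺-old j (rot c))) e)))
    ... | old origin = mk⇔ (λ 0≡l → ⊥-elim (<⇒≢ 1≤l 0≡l)) (λ ())
    ... | new c = mk⇔
      (λ e → trans (block⁺-new (rot c)) (to (g-shift l 1≤l l<kM M∤l c) (trans (sym (block⁺-new c)) e)))
      (λ e → trans (block⁺-new c) (from (g-shift l 1≤l l<kM M∤l c) (trans (sym (block⁺-new (rot c))) e)))

    start-ok⁺ : ∀ i → block⁺ (col i Fin.zero) ≡ 0 → (start ∷ʳ newStart) i ≢ Fin.zero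
    start-ok⁺ i e with view i
    ... | ‵fromℕ = subst (_≢ Fin.zero) (sym (∷ʳ-fromℕ start newStart)) (newStart-ok (trans (sym (block⁺-new Fin.zero)) e))
    ... | ‵inj₁ {i = j} _ = subst (_≢ Fin.zero) (sym (∷ʳ-inject₁ start newStart j))
            (start-ok j (toℕ-injective (φ≡0 _ (trans (sym (block⁺-old j Fin.zero)) e))))

  ω⁺ : OSSP M (suc n)
  ω⁺ = toOSSP blockMap

  module B⁺ = Blocks ω⁺
  module I  = InversionBound ω
  module I⁺ = InversionBound ω⁺

  block-ω⁺ : ∀ x → B⁺.block x ≡ block⁺ x
  block-ω⁺ = block-toOSSP blockMap

  hasColour⁺-old : ∀ a i → hasColourIn block⁺ (inject₁ i) (φ a) ≡ hasColourIn block i a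
  hasColour⁺-old a i = ⌊⌋-⇔
    (mk⇔ (λ (c , e) → c , φ-injective _ _ (trans (sym (block⁺-old i c)) e)) (λ (c , e) → c , trans (block⁺-old i c) (cong φ e)))
    (any? (λ c → block⁺ (col (inject₁ i) c) ≟ φ a)) (any? (λ c → block (col i c) ≟ a))

  minBase⁺-old : ∀ a → a < #blocks → B⁺.minBase′ (φ a) ≡ minBase′ a
  minBase⁺-old zero    _ = trans (minBase-origin B⁺.block (trans B⁺.block-origin (sym φ-zero)))
                                 (sym (minBase-origin block block-origin))
  minBase⁺-old (suc a) a<K with minBase′-witness (suc a) (s≤s z≤n) a<K
  ... | v , _ , v∈a = begin
    B⁺.minBase′ (φ (suc a))                                      ≡⟨ minBase-cong block-ω⁺ (φ (suc a)) ⟩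
    minBase block⁺ (φ (suc a))                                   ≡⟨ minBase-other block⁺ (λ 0≡φ → 1+n≢0 (φ≡0 (suc a) (sym 0≡φ))) ⟩
    firstIdx (λ i → hasColourIn block⁺ i (φ (suc a)))            ≡⟨ firstIdx-inject₁ (λ i → hasColourIn block⁺ i (φ (suc a))) v
                                                                      (subst T (sym (hasColour⁺-old (suc a) v)) v∈a) ⟩
    firstIdx (λ i → hasColourIn block⁺ (inject₁ i) (φ (suc a)))  ≡⟨ firstIdx-cong (hasColour⁺-old (suc a)) ⟩
    firstIdx (λ i → hasColourIn block i (suc a))                 ≡⟨ minBase′-pos (suc a) (s≤s z≤n) ⟨
    minBase′ (suc a)                                             ∎
    where open ≡-Reasoning

  minBase⁺-new : ∀ q → 0 ≢ q → (∀ a → φ a ≢ q) → B⁺.minBase′ q ≡ suc n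
  minBase⁺-new q 0≢q φ≢q = trans (minBase-cong block-ω⁺ q) (trans (minBase-other block⁺ 0≢q)
    (firstIdx-none (λ i → hasColourIn block⁺ i q)
      (λ i p → let (c , e) = hasColourIn-witness block⁺ p in φ≢q (block (col i c)) (trans (sym (block⁺-old i c)) e))))

  zeroBlock⁺-old : ∀ i c → ⌊ OSSP.blk ω⁺ (col (inject₁ i) c) Fin.≟ Fin.zero ⌋ ≡ ⌊ OSSP.blk ω (col i c) Fin.≟ Fin.zero ⌋
  zeroBlock⁺-old i c = ⌊⌋-⇔
    (mk⇔ (λ e → toℕ-injective (φ≡0 _ (trans (sym (trans (block-ω⁺ _) (block⁺-old i c))) (cong toℕ e))))
         (λ e → toℕ-injective (trans (trans (block-ω⁺ _) (block⁺-old i c)) (trans (cong (φ ∘ toℕ) e) φ-zero))))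
    (OSSP.blk ω⁺ (col (inject₁ i) c) Fin.≟ Fin.zero) (OSSP.blk ω (col i c) Fin.≟ Fin.zero)

  inv₂-old : ∀ s → inv₂ ω⁺ (inject₁ s) ≡ inv₂ ω s
  inv₂-old s = countF-cong (λ d → cong₂ _∧_ (zeroBlock⁺-old s c0) (cong₂ _∧_ (zeroBlock⁺-old s d)
    (cong (λ st → ⌊ (0 + (M ∸ toℕ st)) % M <? (toℕ d + (M ∸ toℕ st)) % M ⌋) (∷ʳ-inject₁ start newStart s))))

  η-old : ∀ s → I⁺.#laterBlocks (inject₁ s) ≡ I.#laterBlocks s → lookup (η ω⁺) (inject₁ s) ≡ lookup (η ω) s
  η-old s laterBlocks≡ = trans (I⁺.lookup-η (inject₁ s)) (trans (cong₂ _+_ laterBlocks≡ (inv₂-old s)) (sym (I.lookup-η s)))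

  Tω-old : ∀ s → lookup (Tω ω⁺) (inject₁ s) ≡ lookup (Tω ω) s
  Tω-old s = trans (I⁺.lookup-Tω (inject₁ s)) (trans
    (cong₂ (λ b t → ⌊ b <? suc t ⌋)
      (trans (cong B⁺.minBase′ (trans (block-ω⁺ _) (block⁺-old s Fin.zero))) (minBase⁺-old _ (block<#blocks _)))
      (toℕ-inject₁ s))
    (sym (I.lookup-Tω s)))

  #laterBlocks-new : I⁺.#laterBlocks (fromℕ n) ≡ k⁺ * M ∸ g Fin.zero
  #laterBlocks-new = begin
    I⁺.#laterBlocks (fromℕ n)                               ≡⟨ count-cong B⁺.#blocks (λ j _ → cong (⌊ b <? j ⌋ ∧_)
                                                                 (⌊⌋-true (B⁺.minBase′ j ≤? suc (toℕ (fromℕ n)))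
                                                                   (subst (λ t → B⁺.minBase′ j ≤ suc t) (sym (toℕ-fromℕ n)) (minBase-≤ B⁺.block j)))) ⟩
    count B⁺.#blocks (λ j → ⌊ b <? j ⌋ ∧ true)               ≡⟨ count-cong B⁺.#blocks (λ j _ → ∧-identityʳ ⌊ b <? j ⌋) ⟩
    count B⁺.#blocks (λ j → ⌊ b <? j ⌋)                      ≡⟨ count-> B⁺.#blocks b ⟩
    B⁺.#blocks ∸ suc b                                      ≡⟨ cong (λ b → k⁺ * M ∸ b) (trans (block-ω⁺ _) (block⁺-new Fin.zero)) ⟩
    k⁺ * M ∸ g Fin.zero                                     ∎
    where
    open ≡-Reasoning
    b = B⁺.block (col (fromℕ n) Fin.zero)

  η-new : lookup (η ω⁺) (fromℕ n) ≡ k⁺ * M ∸ g Fin.zero + inv₂ ω⁺ (fromℕ n)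
  η-new = trans (I⁺.lookup-η (fromℕ n)) (cong (_+ inv₂ ω⁺ (fromℕ n)) #laterBlocks-new)

  inv₂-new-zeroBlock : g Fin.zero ≡ 0 → inv₂ ω⁺ (fromℕ n) ≡ toℕ newStart ∸ 1
  inv₂-new-zeroBlock g0≡0 = trans (I⁺.inv₂-zeroBlock (fromℕ n) (trans (block-ω⁺ _) (trans (block⁺-new Fin.zero) g0≡0)))
                                  (cong (λ s → toℕ s ∸ 1) (∷ʳ-fromℕ start newStart))

  inv₂-new-nonzeroBlock : g Fin.zero ≢ 0 → inv₂ ω⁺ (fromℕ n) ≡ 0
  inv₂-new-nonzeroBlock g0≢0 = I⁺.inv₂-nonzeroBlock (fromℕ n) (g0≢0 ∘ trans (sym (trans (block-ω⁺ _) (block⁺-new Fin.zero))))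

  Tω-new : lookup (Tω ω⁺) (fromℕ n) ≡ ⌊ B⁺.minBase′ (g Fin.zero) <? suc n ⌋
  Tω-new = trans (I⁺.lookup-Tω (fromℕ n))
    (cong₂ (λ b t → ⌊ B⁺.minBase′ b <? suc t ⌋) (trans (block-ω⁺ _) (block⁺-new Fin.zero)) (toℕ-fromℕ n))

module _ {m' : ℕ} where
  private M = suc m'

  -- The colours of a new base spread over group p, i.e. blocks p * M + 1, …, p * M + M, rotated by r.
  inGroup : ℕ → ℕ → Fin M → ℕ
  inGroup p r c = suc (p * M + (r + toℕ c) % M)

  inGroup-zero : ∀ p {r} → r < M → inGroup p r Fin.zero ≡ suc (p * M + r)
  inGroup-zero p {r} r<M = cong (λ x → suc (p * M + x)) (trans (cong (_% M) (+-identityʳ r)) (m<n⇒m%n≡m r<M))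

  inGroup-≤ : ∀ p r c → inGroup p r c ≤ p * M + M
  inGroup-≤ p r c = subst (_≤ p * M + M) (+-suc (p * M) _) (+-monoʳ-≤ (p * M) (m%n<n (r + toℕ c) M))

  inGroup-onto : ∀ p {r e} → r < M → e < M → ∃ λ c → inGroup p r c ≡ suc (p * M + e)
  inGroup-onto p {r} {e} r<M e<M = fromℕ< (m%n<n (e + (M ∸ r)) M) , cong (λ x → suc (p * M + x)) (begin
    (r + toℕ (fromℕ< (m%n<n (e + (M ∸ r)) M))) % M  ≡⟨ cong (λ x → (r + x) % M) (toℕ-fromℕ< _) ⟩
    (r + (e + (M ∸ r)) % M) % M                     ≡⟨ cong (_% M) (+-comm r _) ⟩
    ((e + (M ∸ r)) % M + r) % M                     ≡⟨ %-+ˡ (e + (M ∸ r)) r ⟩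
    (e + (M ∸ r) + r) % M                           ≡⟨ cong (_% M) (trans (+-assoc e _ r) (cong (e +_) (m∸n+n≡m (<⇒≤ r<M)))) ⟩
    (e + M) % M                                     ≡⟨ [m+n]%n≡m%n e M ⟩
    e % M                                           ≡⟨ m<n⇒m%n≡m e<M ⟩
    e                                               ∎)
    where open ≡-Reasoning

  inGroup-shift : ∀ p r l c → ¬ (M ∣ l) → (inGroup p r c ≡ l) ⇔ (inGroup p r (rot c) ≡ suc l)
  inGroup-shift p r l c M∤l with (r + toℕ c) % M <? m'
  ... | yes f<m' = mk⇔ (λ e → trans next (cong suc e)) (λ e → suc-injective (trans (sym next) e))
    where
    next : inGroup p r (rot c) ≡ suc (inGroup p r c)
    next = trans (cong (λ x → suc (p * M + x)) (trans (offset-rot r c) (m<n⇒m%n≡m (s≤s f<m'))))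
                 (cong suc (+-suc (p * M) _))
  ... | no  f≮m' = mk⇔ (λ e → ⊥-elim (M∤l (subst (M ∣_) e last∣)))
                        (λ e → ⊥-elim (M∤l (subst (M ∣_) (suc-injective (trans (sym first) e)) first∣)))
    where
    f≡m' : (r + toℕ c) % M ≡ m'
    f≡m' = ≤-antisym (≤-pred (m%n<n (r + toℕ c) M)) (≮⇒≥ f≮m')
    last∣ : M ∣ inGroup p r c
    last∣ = subst (M ∣_) (sym (trans (cong (λ x → suc (p * M + x)) f≡m') (trans (sym (+-suc (p * M) m')) (+-comm (p * M) M))))
                  (n∣m*n (suc p))
    first∣ : M ∣ p * M + 0
    first∣ = subst (M ∣_) (sym (+-identityʳ _)) (n∣m*n p)
    first : inGroup p r (rot c) ≡ suc (p * M + 0)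
    first = cong (λ x → suc (p * M + x)) (trans (offset-rot r c) (trans (cong (λ x → suc x % M) f≡m') (n%n≡0 M)))

module SameBlocks {m' n : ℕ} (ω : OSSP (suc m') n) (g : Fin (suc m') → ℕ) (newStart : Fin (suc m'))
  (g<          : ∀ c → g c < Blocks.#blocks ω)
  (g-zeroBlock : ∀ c d → g c ≡ 0 → g d ≡ 0)
  (g-shift     : ∀ l → 1 ≤ l → l < OSSP.k ω * suc m' → ¬ (suc m' ∣ l) → ∀ c → (g c ≡ l) ⇔ (g (rot c) ≡ suc l))
  (newStart-ok : g Fin.zero ≡ 0 → newStart ≢ Fin.zero)
  where
  open Blocks ω

  open Extension ω k id g newStart (λ _ _ e → e) refl (λ _ a<K → a<K) g< (λ l l<K → inj₁ (l , l<K , refl)) g-zeroBlock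
    (λ l 1≤l l<kM M∤l x → mk⇔ (block-ζ l 1≤l l<kM M∤l x) (block-ζ⁻¹ l 1≤l l<kM M∤l x)) g-shift newStart-ok
    public

  #laterBlocks-old : ∀ s → I⁺.#laterBlocks (inject₁ s) ≡ I.#laterBlocks s
  #laterBlocks-old s = count-cong #blocks (λ j j<K → cong₂ (λ b mb → ⌊ b <? j ⌋ ∧ mb)
    (trans (block-ω⁺ _) (block⁺-old s Fin.zero))
    (cong₂ (λ mb t → ⌊ mb ≤? suc t ⌋) (minBase⁺-old j j<K) (toℕ-inject₁ s)))

  Tω-new-true : lookup (Tω ω⁺) (fromℕ n) ≡ true
  Tω-new-true = trans Tω-new (⌊⌋-true (B⁺.minBase′ (g Fin.zero) <? suc n)
    (s≤s (subst (_≤ n) (sym (minBase⁺-old (g Fin.zero) (g< Fin.zero))) (minBase-≤ block (g Fin.zero)))))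

module NewGroup {m' n : ℕ} (ω : OSSP (suc m') n) (p r : ℕ) (p≤k : p ≤ OSSP.k ω) (r<M : r < suc m') where
  open Blocks ω

  pM : ℕ
  pM = p * M

  pM≤kM : pM ≤ k * M
  pM≤kM = *-monoˡ-≤ M p≤k

  -- Make room for a new group after the first p groups.
  shiftAbove : ℕ → ℕ
  shiftAbove a = if ⌊ a ≤? pM ⌋ then a else M + a

  data ShiftAbove (a : ℕ) : ℕ → Set where
    below : a ≤ pM → ShiftAbove a a
    above : pM < a → ShiftAbove a (M + a)

  shiftAbove-view : ∀ a → ShiftAbove a (shiftAbove a)
  shiftAbove-view a with a ≤? pM
  ... | yes a≤pM = below a≤pM
  ... | no  a≰pM = above (≰⇒> a≰pM)

  shiftAbove-below : ∀ {a} → a ≤ pM → shiftAbove a ≡ a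
  shiftAbove-below {a} a≤pM with shiftAbove a | shiftAbove-view a
  ... | _ | below _    = refl
  ... | _ | above pM<a = ⊥-elim (<⇒≱ pM<a a≤pM)

  shiftAbove-above : ∀ {a} → pM < a → shiftAbove a ≡ M + a
  shiftAbove-above {a} pM<a with shiftAbove a | shiftAbove-view a
  ... | _ | below a≤pM = ⊥-elim (<⇒≱ pM<a a≤pM)
  ... | _ | above _    = refl

  shiftAbove-mono-< : ∀ {a b} → (a < b) ⇔ (shiftAbove a < shiftAbove b)
  shiftAbove-mono-< {a} {b} with shiftAbove a | shiftAbove-view a | shiftAbove b | shiftAbove-view b
  ... | _ | below _    | _ | below _    = mk⇔ id id
  ... | _ | below a≤pM | _ | above pM<b = mk⇔ (λ _ → ≤-trans (s≤s a≤pM) (≤-trans pM<b (m≤n+m b M)))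
                                              (λ _ → ≤-<-trans a≤pM pM<b)
  ... | _ | above pM<a | _ | below b≤pM = mk⇔ (λ a<b → ⊥-elim (<-asym (<-≤-trans a<b b≤pM) pM<a))
                                              (λ a'<b → ⊥-elim (<⇒≱ (≤-<-trans (m≤n+m a M) a'<b) (<⇒≤ (≤-<-trans b≤pM pM<a))))
  ... | _ | above _    | _ | above _    = mk⇔ (+-monoʳ-< M) (+-cancelˡ-< M a b)

  shiftAbove-injective : ∀ a b → shiftAbove a ≡ shiftAbove b → a ≡ b
  shiftAbove-injective a b e with <-cmp a b
  ... | tri< a<b _ _ = ⊥-elim (<-irrefl e (to shiftAbove-mono-< a<b))
  ... | tri≈ _ a≡b _ = a≡b
  ... | tri> _ _ b<a = ⊥-elim (<-irrefl (sym e) (to shiftAbove-mono-< b<a))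

  shiftAbove-below-⇔ : ∀ {a l} → l ≤ pM → (shiftAbove a ≡ l) ⇔ (a ≡ l)
  shiftAbove-below-⇔ {a} {l} l≤pM with shiftAbove a | shiftAbove-view a
  ... | _ | below _    = mk⇔ id id
  ... | _ | above pM<a = mk⇔ (λ e → ⊥-elim (<⇒≱ (<-≤-trans pM<a (m≤n+m a M)) (subst (_≤ pM) (sym e) l≤pM)))
                             (λ e → ⊥-elim (<⇒≱ pM<a (subst (_≤ pM) (sym e) l≤pM)))

  shiftAbove-gap : ∀ a {l} → pM < l → l ≤ pM + M → shiftAbove a ≢ l
  shiftAbove-gap a {l} pM<l l≤ e with shiftAbove a | shiftAbove-view a
  ... | _ | below a≤pM = <⇒≱ pM<l (subst (_≤ pM) e a≤pM)
  ... | _ | above pM<a = <⇒≱ (+-monoʳ-< M pM<a) (subst (_≤ M + pM) (sym e) (subst (l ≤_) (+-comm pM M) l≤))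

  shiftAbove-above-⇔ : ∀ {a l} → pM + M < l → (shiftAbove a ≡ l) ⇔ (M + a ≡ l)
  shiftAbove-above-⇔ {a} {l} l> with shiftAbove a | shiftAbove-view a
  ... | _ | above _    = mk⇔ id id
  ... | _ | below a≤pM = mk⇔ (λ e → ⊥-elim (<⇒≱ (≤-<-trans (m≤m+n pM M) l>) (subst (_≤ pM) e a≤pM)))
                             (λ e → ⊥-elim (<⇒≱ l> (subst (_≤ pM + M) e (subst (M + a ≤_) (+-comm M pM) (+-monoʳ-≤ M a≤pM)))))

  private
    K⁺ : ℕ
    K⁺ = suc (suc k * M)

    below-shift : ∀ l → 1 ≤ l → l < pM → ¬ (M ∣ l) → ∀ x →
                  (shiftAbove (block x) ≡ l) ⇔ (shiftAbove (block (ζ x)) ≡ suc l)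
    below-shift l 1≤l l<pM M∤l x = ⇔-trans (shiftAbove-below-⇔ (<⇒≤ l<pM))
      (⇔-trans (mk⇔ (block-ζ l 1≤l l<kM M∤l x) (block-ζ⁻¹ l 1≤l l<kM M∤l x)) (⇔-sym (shiftAbove-below-⇔ l<pM)))
      where l<kM = <-≤-trans l<pM pM≤kM

    above-shift : ∀ l′ → pM < l′ → l′ < k * M → ¬ (M ∣ l′) → ∀ x →
                  (shiftAbove (block x) ≡ M + l′) ⇔ (shiftAbove (block (ζ x)) ≡ M + suc l′)
    above-shift l′ pM<l′ l′<kM M∤l′ x = ⇔-trans (shiftAbove-above-⇔ (M+-above pM<l′))
      (⇔-trans (M+-⇔ (block x) l′)
      (⇔-trans (mk⇔ (block-ζ l′ 1≤l′ l′<kM M∤l′ x) (block-ζ⁻¹ l′ 1≤l′ l′<kM M∤l′ x))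
      (⇔-trans (⇔-sym (M+-⇔ (block (ζ x)) (suc l′)))
               (⇔-sym (shiftAbove-above-⇔ (M+-above (<-trans pM<l′ (n<1+n l′))))))))
      where
      1≤l′ : 1 ≤ l′
      1≤l′ = ≤-trans (s≤s z≤n) pM<l′
      M+-above : ∀ {y} → pM < y → pM + M < M + y
      M+-above {y} pM<y = subst (_< M + y) (+-comm M pM) (+-monoʳ-< M pM<y)
      M+-⇔ : ∀ a y → (M + a ≡ M + y) ⇔ (a ≡ y)
      M+-⇔ a y = mk⇔ (+-cancelˡ-≡ M a y) (cong (M +_))

    gap-shift : ∀ l → pM < l → l < pM + M → ∀ x → (shiftAbove (block x) ≡ l) ⇔ (shiftAbove (block (ζ x)) ≡ suc l)
    gap-shift l pM<l l<pM+M x = mk⇔ (⊥-elim ∘ shiftAbove-gap (block x) pM<l (<⇒≤ l<pM+M))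
                                    (⊥-elim ∘ shiftAbove-gap (block (ζ x)) (<-trans pM<l (n<1+n l)) l<pM+M)

    shiftAbove-shift : ∀ l → 1 ≤ l → l < suc k * M → ¬ (M ∣ l) → ∀ x →
                       (shiftAbove (block x) ≡ l) ⇔ (shiftAbove (block (ζ x)) ≡ suc l)
    shiftAbove-shift l 1≤l l<K M∤l x with <-cmp l pM
    ... | tri< l<pM _ _ = below-shift l 1≤l l<pM M∤l x
    ... | tri≈ _ refl _ = ⊥-elim (M∤l (n∣m*n p))
    ... | tri> _ _ pM<l with <-cmp l (pM + M)
    ...   | tri< l<pM+M _ _ = gap-shift l pM<l l<pM+M x
    ...   | tri≈ _ refl _   = ⊥-elim (M∤l (subst (M ∣_) (+-comm M pM) (n∣m*n (suc p))))
    ...   | tri> _ _ l>     = subst₂ (λ u v → (shiftAbove (block x) ≡ u) ⇔ (shiftAbove (block (ζ x)) ≡ v))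
                                     M+l′≡l (trans (+-suc M l′) (cong suc M+l′≡l))
                                     (above-shift l′ pM<l′ l′<kM M∤l′ x)
      where
      l′ = l ∸ M
      M+l′≡l : M + l′ ≡ l
      M+l′≡l = m+[n∸m]≡n (≤-trans (m≤n+m M pM) (<⇒≤ l>))
      pM<l′ : pM < l′
      pM<l′ = +-cancelˡ-< M pM l′ (subst (M + pM <_) (sym M+l′≡l) (subst (_< l) (+-comm pM M) l>))
      l′<kM : l′ < k * M
      l′<kM = +-cancelˡ-< M l′ (k * M) (subst (_< M + k * M) (sym M+l′≡l) l<K)
      M∤l′ : ¬ (M ∣ l′)
      M∤l′ M∣l′ = M∤l (subst (M ∣_) M+l′≡l (∣m∣n⇒∣m+n ∣-refl M∣l′))

    shiftAbove< : ∀ a → a < #blocks → shiftAbove a < K⁺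
    shiftAbove< a a<K with shiftAbove a | shiftAbove-view a
    ... | _ | below _ = ≤-trans a<K (s≤s (m≤n+m (k * M) M))
    ... | _ | above _ = s≤s (+-monoʳ-≤ M (≤-pred a<K))

    inGroup< : ∀ c → inGroup p r c < K⁺
    inGroup< c = s≤s (≤-trans (inGroup-≤ p r c) (subst (pM + M ≤_) (+-comm (k * M) M) (+-monoˡ-≤ M pM≤kM)))

    shiftAbove-or-inGroup : ∀ l → l < K⁺ → (∃ λ a → a < #blocks × shiftAbove a ≡ l) ⊎ (∃ λ c → inGroup p r c ≡ l)
    shiftAbove-or-inGroup l l<K⁺ with l ≤? pM
    ... | yes l≤pM = inj₁ (l , s≤s (≤-trans l≤pM pM≤kM) , shiftAbove-below l≤pM)
    ... | no  l≰pM with l ≤? pM + M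
    ...   | yes l≤pM+M = inj₂ (let (c , e) = inGroup-onto p r<M e<M in c , trans e (m+[n∸m]≡n pM<l))
      where
      pM<l : pM < l
      pM<l = ≰⇒> l≰pM
      e<M : l ∸ suc pM < M
      e<M = +-cancelˡ-< (suc pM) _ _ (subst (_≤ suc pM + M) (sym (cong suc (m+[n∸m]≡n pM<l))) (s≤s l≤pM+M))
    ...   | no  l≰pM+M = inj₁ (l ∸ M , a<K , trans (shiftAbove-above pM<a) (m+[n∸m]≡n M≤l))
      where
      M≤l : M ≤ l
      M≤l = ≤-trans (m≤n+m M pM) (<⇒≤ (≰⇒> l≰pM+M))
      pM<a : pM < l ∸ M
      pM<a = +-cancelʳ-< M pM (l ∸ M) (subst (pM + M <_) (sym (m∸n+n≡m M≤l)) (≰⇒> l≰pM+M))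
      a<K : l ∸ M < #blocks
      a<K = +-cancelˡ-< M (l ∸ M) #blocks (subst (_< M + #blocks) (sym (m+[n∸m]≡n M≤l)) (subst (l <_) (sym (+-suc M (k * M))) l<K⁺))

  open Extension ω (suc k) shiftAbove (inGroup p r) Fin.zero shiftAbove-injective (shiftAbove-below z≤n)
    shiftAbove< inGroup< shiftAbove-or-inGroup (λ _ _ ()) shiftAbove-shift (λ l _ _ M∤l c → inGroup-shift p r l c M∤l) (λ ())
    public

  minBase⁺-gap : ∀ e → e < M → B⁺.minBase′ (suc pM + e) ≡ suc n
  minBase⁺-gap e e<M = minBase⁺-new (suc pM + e) (λ ())
    (λ a → shiftAbove-gap a (s≤s (m≤m+n pM e)) (subst (_≤ pM + M) (+-suc pM e) (+-monoʳ-≤ pM e<M)))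

  #laterBlocks-old : ∀ s → I⁺.#laterBlocks (inject₁ s) ≡ I.#laterBlocks s
  #laterBlocks-old s = begin
    count K⁺ P                    ≡⟨ cong (λ K → count K P) K⁺≡ ⟩
    count (suc pM + (M + D)) P    ≡⟨ count-+-gap (suc pM) M D P Q P≡Q-below P-gap P≡Q-above ⟩
    count (suc pM + D) Q          ≡⟨ cong (λ K → count K Q) #blocks≡ ⟨
    count #blocks Q               ∎
    where
    open ≡-Reasoning
    b = block (col s Fin.zero)
    P Q : ℕ → Bool
    P j = ⌊ B⁺.block (col (inject₁ s) Fin.zero) <? j ⌋ ∧ ⌊ B⁺.minBase′ j ≤? suc (toℕ (inject₁ s)) ⌋
    Q j = ⌊ b <? j ⌋ ∧ ⌊ minBase′ j ≤? suc (toℕ s) ⌋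
    D = k * M ∸ pM
    pM+D≡kM : pM + D ≡ k * M
    pM+D≡kM = m+[n∸m]≡n pM≤kM
    #blocks≡ : #blocks ≡ suc pM + D
    #blocks≡ = cong suc (sym pM+D≡kM)
    K⁺≡ : K⁺ ≡ suc pM + (M + D)
    K⁺≡ = cong suc (trans (cong (M +_) (sym pM+D≡kM)) (x∙yz≈y∙xz M pM D))
    P∘shiftAbove : ∀ j → j < #blocks → P (shiftAbove j) ≡ Q j
    P∘shiftAbove j j<K = cong₂ _∧_
      (trans (cong (λ b′ → ⌊ b′ <? shiftAbove j ⌋) (trans (block-ω⁺ _) (block⁺-old s Fin.zero)))
             (⌊⌋-⇔ (⇔-sym shiftAbove-mono-<) (shiftAbove b <? shiftAbove j) (b <? j)))
      (cong₂ (λ mb t → ⌊ mb ≤? suc t ⌋) (minBase⁺-old j j<K) (toℕ-inject₁ s))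
    P≡Q-below : ∀ j → j < suc pM → P j ≡ Q j
    P≡Q-below j j≤pM = trans (cong P (sym (shiftAbove-below (≤-pred j≤pM))))
                         (P∘shiftAbove j (<-≤-trans j≤pM (s≤s pM≤kM)))
    P-gap : ∀ e → e < M → ¬ T (P (suc pM + e))
    P-gap e e<M Pj = <⇒≱ (s≤s (subst (_< n) (sym (toℕ-inject₁ s)) (toℕ<n s)))
      (subst (_≤ suc (toℕ (inject₁ s))) (minBase⁺-gap e e<M)
        (proj₂ (T-⌊⌋∧⌊⌋ (B⁺.block (col (inject₁ s) Fin.zero) <? suc pM + e)
                        (B⁺.minBase′ (suc pM + e) ≤? suc (toℕ (inject₁ s))) Pj)))
    P≡Q-above : ∀ e → e < D → P (suc pM + (M + e)) ≡ Q (suc pM + e)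
    P≡Q-above e e<D = trans (cong P (trans (x∙yz≈y∙xz (suc pM) M e) (sym (shiftAbove-above (s≤s (m≤m+n pM e))))))
                            (P∘shiftAbove (suc pM + e) (subst (suc pM + e <_) (sym #blocks≡) (+-monoʳ-< (suc pM) e<D)))

  Tω-new-false : lookup (Tω ω⁺) (fromℕ n) ≡ false
  Tω-new-false = trans Tω-new (⌊⌋-false (B⁺.minBase′ (inGroup p r Fin.zero) <? suc n)
    (<-irrefl (trans (cong B⁺.minBase′ (inGroup-zero p r<M)) (minBase⁺-gap r r<M))))

module _ {m' : ℕ} where
  private M = suc m'

  -- Colour 0 of a base placed in block p * M + r + 1 of q groups has exactly α blocks after it.
  position-in-groups : ∀ q {α} → α < q * M → ∃₂ λ p r → p < q × r < M × q * M ∸ suc (p * M + r) ≡ α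
  position-in-groups q {α} α<qM = e / M , e % M , m<n*o⇒m/o<n e<qM , m%n<n e M , (begin
    q * M ∸ suc (e / M * M + e % M)   ≡⟨ cong (λ x → q * M ∸ suc x) (trans (+-comm _ (e % M)) (sym (m≡m%n+[m/n]*n e M))) ⟩
    q * M ∸ suc e                     ≡⟨ cong (q * M ∸_) (+-∸-assoc 1 α<qM) ⟨
    q * M ∸ (q * M ∸ α)               ≡⟨ m∸[m∸n]≡n (<⇒≤ α<qM) ⟩
    α                                 ∎)
    where
    open ≡-Reasoning
    e = q * M ∸ suc α
    e<qM : e < q * M
    e<qM = ∸-monoʳ-< (s≤s z≤n) α<qM

  -- A base in the zero block with start colour s has k * M inversions of type (1) and s ∸ 1 of type (2).
  start-colour : ∀ k {α} → k * M ≤ α → α + 2 ≤ suc k * M → ∃ λ (s : Fin M) → s ≢ Fin.zero × k * M + (toℕ s ∸ 1) ≡ α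
  start-colour k {α} kM≤α α+2≤ = fromℕ< d+1<M , s≢0 , trans (cong (λ x → k * M + (x ∸ 1)) (toℕ-fromℕ< d+1<M)) (m+[n∸m]≡n kM≤α)
    where
    d = α ∸ k * M
    d+1<M : suc d < M
    d+1<M = +-cancelʳ-≤ (k * M) (suc (suc d)) M (begin
      suc (suc d) + k * M   ≡⟨ cong (λ x → suc (suc x)) (m∸n+n≡m kM≤α) ⟩
      suc (suc α)           ≡⟨ +-comm 2 α ⟩
      α + 2                 ≤⟨ α+2≤ ⟩
      M + k * M             ∎)
      where open ≤-Reasoning
    s≢0 : fromℕ< d+1<M ≢ Fin.zero
    s≢0 s≡0 = 1+n≢0 (trans (sym (toℕ-fromℕ< d+1<M)) (cong toℕ s≡0))

#outside≤-inject₁ : ∀ {n} (inT : Fin (suc n) → Bool) t → #outside≤ inT (inject₁ t) ≡ #outside≤ (inT ∘ inject₁) t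
#outside≤-inject₁ {n} inT t = begin
  #outside≤ inT (inject₁ t)
    ≡⟨ countF-snoc (λ u → not (inT u) ∧ ⌊ toℕ u ≤? toℕ (inject₁ t) ⌋) ⟩
  countF (λ u → not (inT (inject₁ u)) ∧ ⌊ toℕ (inject₁ u) ≤? toℕ (inject₁ t) ⌋) + indicator (last ∧ ⌊ toℕ (fromℕ n) ≤? toℕ (inject₁ t) ⌋)
    ≡⟨ cong₂ _+_ (countF-cong (λ u → cong₂ (λ a b → not (inT (inject₁ u)) ∧ ⌊ a ≤? b ⌋) (toℕ-inject₁ u) (toℕ-inject₁ t)))
                 (cong (λ b → indicator (last ∧ b)) (⌊⌋-false (toℕ (fromℕ n) ≤? toℕ (inject₁ t)) n≰t)) ⟩
  #outside≤ (inT ∘ inject₁) t + indicator (last ∧ false)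
    ≡⟨ cong (λ b → #outside≤ (inT ∘ inject₁) t + indicator b) (∧-zeroʳ last) ⟩
  #outside≤ (inT ∘ inject₁) t + 0
    ≡⟨ +-identityʳ _ ⟩
  #outside≤ (inT ∘ inject₁) t ∎
  where
  open ≡-Reasoning
  last = not (inT (fromℕ n))
  n≰t : ¬ (toℕ (fromℕ n) ≤ toℕ (inject₁ t))
  n≰t = <⇒≱ (subst₂ _<_ (sym (toℕ-inject₁ t)) (sym (toℕ-fromℕ n)) (toℕ<n t))

#outside≤-fromℕ : ∀ {n} (inT : Fin (suc n) → Bool) →
                  #outside≤ inT (fromℕ n) ≡ countF (not ∘ inT ∘ inject₁) + indicator (not (inT (fromℕ n)))
#outside≤-fromℕ {n} inT = trans (countF-snoc (λ u → not (inT u) ∧ ⌊ toℕ u ≤? toℕ (fromℕ n) ⌋)) (cong₂ _+_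
  (countF-cong (λ u → trans (cong (not (inT (inject₁ u)) ∧_) (⌊⌋-true (toℕ (inject₁ u) ≤? toℕ (fromℕ n)) u≤n)) (∧-identityʳ _)))
  (cong indicator (trans (cong (not (inT (fromℕ n)) ∧_) (⌊⌋-true (toℕ (fromℕ n) ≤? toℕ (fromℕ n)) ≤-refl)) (∧-identityʳ _))))
  where
  u≤n : ∀ {u} → toℕ (inject₁ u) ≤ toℕ (fromℕ n)
  u≤n {u} = subst₂ _≤_ (sym (toℕ-inject₁ u)) (sym (toℕ-fromℕ n)) (<⇒≤ (toℕ<n u))

Realisation : (m' n : ℕ) → (Fin n → ℕ) → (Fin n → Bool) → Set
Realisation m' n α inT = Σ (OSSP (suc m') n) λ ω →
  (∀ t → lookup (η ω) t ≡ α t) × (∀ t → lookup (Tω ω) t ≡ inT t) × OSSP.k ω ≡ countF (not ∘ inT)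

realisation-∷ʳ : ∀ {m' n} {α : Fin (suc n) → ℕ} {inT : Fin (suc n) → Bool} →
  (IH : Realisation m' n (α ∘ inject₁) (inT ∘ inject₁)) (ω⁺ : OSSP (suc m') (suc n)) →
  (∀ s → lookup (η ω⁺) (inject₁ s) ≡ lookup (η (proj₁ IH)) s) →
  (∀ s → lookup (Tω ω⁺) (inject₁ s) ≡ lookup (Tω (proj₁ IH)) s) →
  lookup (η ω⁺) (fromℕ n) ≡ α (fromℕ n) → lookup (Tω ω⁺) (fromℕ n) ≡ inT (fromℕ n) →
  OSSP.k ω⁺ ≡ OSSP.k (proj₁ IH) + indicator (not (inT (fromℕ n))) →
  Realisation m' (suc n) α inT
realisation-∷ʳ {α = α} {inT} (ω , η≡α , Tω≡inT , k≡) ω⁺ η-old Tω-old η-new Tω-new k⁺≡ =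
  ω⁺ , η≡ , Tω≡ , trans k⁺≡ (trans (cong (_+ _) k≡) (sym (countF-snoc (not ∘ inT))))
  where
  η≡ : ∀ t → lookup (η ω⁺) t ≡ α t
  η≡ t with view t
  ... | ‵fromℕ = η-new
  ... | ‵inj₁ {i = s} _ = trans (η-old s) (η≡α s)
  Tω≡ : ∀ t → lookup (Tω ω⁺) t ≡ inT t
  Tω≡ t with view t
  ... | ‵fromℕ = Tω-new
  ... | ‵inj₁ {i = s} _ = trans (Tω-old s) (Tω≡inT s)

module _ {m' n : ℕ} {α : Fin (suc n) → ℕ} {inT : Fin (suc n) → Bool}
         (IH : Realisation m' n (α ∘ inject₁) (inT ∘ inject₁)) where
  private
    M = suc m'
    ω = proj₁ IH
    k = OSSP.k ω
    a = α (fromℕ n)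

  realise-inZeroBlock : inT (fromℕ n) ≡ true → k * M ≤ a → a + 2 ≤ suc k * M → Realisation m' (suc n) α inT
  realise-inZeroBlock inT-last kM≤a a+2≤ with start-colour k kM≤a a+2≤
  ... | st , st≢0 , kM+st∸1≡a = realisation-∷ʳ IH ω⁺ (λ s → η-old s (#laterBlocks-old s)) Tω-old
          (trans η-new (trans (cong (k * M +_) (inv₂-new-zeroBlock refl)) kM+st∸1≡a))
          (trans Tω-new-true (sym inT-last))
          (trans (sym (+-identityʳ k)) (cong (λ b → k + indicator (not b)) (sym inT-last)))
    where
    open SameBlocks ω (λ _ → 0) st (λ _ → s≤s z≤n) (λ _ _ _ → refl)
      (λ l 1≤l _ _ _ → mk⇔ (λ 0≡l → ⊥-elim (<⇒≢ 1≤l 0≡l)) (λ ())) (λ _ → st≢0)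

  realise-inOldGroup : inT (fromℕ n) ≡ true → a < k * M → Realisation m' (suc n) α inT
  realise-inOldGroup inT-last a<kM with position-in-groups k a<kM
  ... | p , r , p<k , r<M , kM∸[pM+r+1]≡a = realisation-∷ʳ IH ω⁺ (λ s → η-old s (#laterBlocks-old s)) Tω-old
          (trans η-new (trans (cong₂ _+_ (cong (k * M ∸_) (inGroup-zero p r<M)) (inv₂-new-nonzeroBlock (λ ())))
                              (trans (+-identityʳ _) kM∸[pM+r+1]≡a)))
          (trans Tω-new-true (sym inT-last))
          (trans (sym (+-identityʳ k)) (cong (λ b → k + indicator (not b)) (sym inT-last)))
    where
    open SameBlocks ω (inGroup p r) Fin.zero
      (λ c → s≤s (≤-trans (inGroup-≤ p r c) (subst (_≤ k * M) (+-comm M (p * M)) (*-monoˡ-≤ M p<k))))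
      (λ _ _ ()) (λ l _ _ M∤l c → inGroup-shift p r l c M∤l) (λ ())

  realise-inNewGroup : inT (fromℕ n) ≡ false → a < suc k * M → Realisation m' (suc n) α inT
  realise-inNewGroup inT-last a<k+1M with position-in-groups (suc k) a<k+1M
  ... | p , r , p<k+1 , r<M , k+1M∸[pM+r+1]≡a = realisation-∷ʳ IH ω⁺ (λ s → η-old s (#laterBlocks-old s)) Tω-old
          (trans η-new (trans (cong₂ _+_ (cong (suc k * M ∸_) (inGroup-zero p r<M)) (inv₂-new-nonzeroBlock (λ ())))
                              (trans (+-identityʳ _) k+1M∸[pM+r+1]≡a)))
          (trans Tω-new-false (sym inT-last))
          (trans (+-comm 1 k) (cong (λ b → k + indicator (not b)) (sym inT-last)))
    where open NewGroup ω p r (≤-pred p<k+1) r<M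

  realise-∷ʳ : WithinBeta M (k + indicator (not (inT (fromℕ n)))) (inT (fromℕ n)) a → Realisation m' (suc n) α inT
  realise-∷ʳ = byLast (inT (fromℕ n)) refl
    where
    byLast : ∀ b → inT (fromℕ n) ≡ b → WithinBeta M (k + indicator (not b)) b a → Realisation m' (suc n) α inT
    byLast true  inT-last a+2≤ with k * M ≤? a
    ... | yes kM≤a = realise-inZeroBlock inT-last kM≤a (subst (λ x → a + 2 ≤ suc x * M) (+-identityʳ k) a+2≤)
    ... | no  kM≰a = realise-inOldGroup inT-last (≰⇒> kM≰a)
    byLast false inT-last a+1≤ = realise-inNewGroup inT-last (subst₂ _≤_ (+-comm a 1) (cong (_* M) (+-comm k 1)) a+1≤)

emptyOSSP : ∀ {m'} → OSSP (suc m') 0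
emptyOSSP = record
  { k         = 0
  ; blk       = λ _ → Fin.zero
  ; nonempty  = λ { Fin.zero → origin , refl }
  ; zero∈S₀   = refl
  ; S₀-closed = λ ()
  ; shift     = λ _ _ ()
  ; start     = λ ()
  ; start-ok  = λ ()
  }

realise : ∀ {m'} n (α : Fin n → ℕ) (inT : Fin n → Bool) →
          (∀ t → WithinBeta (suc m') (#outside≤ inT t) (inT t) (α t)) → Realisation m' n α inT
realise zero    α inT _      = emptyOSSP , (λ ()) , (λ ()) , refl
realise {m'} (suc n) α inT within = realise-∷ʳ IH (subst (λ c → WithinBeta (suc m') c (inT (fromℕ n)) (α (fromℕ n)))
                                                    (trans (#outside≤-fromℕ inT) (cong (_+ _) (sym k≡)))
                                                    (within (fromℕ n)))
  where
  IH = realise n (α ∘ inject₁) (inT ∘ inject₁) (λ t → subst (λ c → WithinBeta (suc m') c (inT (inject₁ t)) (α (inject₁ t)))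
                                                            (#outside≤-inject₁ inT t) (within (inject₁ t)))
  k≡ = proj₂ (proj₂ (proj₂ IH))

lookup-extensionality : ∀ {a} {A : Set a} {n} {u v : Vec A n} → (∀ t → lookup u t ≡ lookup v t) → u ≡ v
lookup-extensionality {u = u} {v} u≗v = trans (sym (tabulate∘lookup u)) (trans (tabulate-cong u≗v) (tabulate∘lookup v))

proposition5p8 : (m n : ℕ) → {{_ : NonZero m}} →
    (mono : Monomial n) → (mono ∈SA[ m ]) ⇔ (mono ∈Im[ m ])
proposition5p8 (suc m') n (α , S) = mk⇔ realised (λ { (ω , refl) → InversionBound.η-∈SA ω })
  where
  realised : (α , S) ∈SA[ suc m' ] → (α , S) ∈Im[ suc m' ]
  realised α∈SA with realise n (lookup α) (lookup S) (λ t → to (≤β⇔WithinBeta (suc m') S t (lookup α t)) (α∈SA t))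
  ... | ω , η≡α , Tω≡S , _ = ω , cong₂ _,_ (lookup-extensionality η≡α) (lookup-extensionality Tω≡S)
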